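{- Consider the $A_2$ $T$-system $$T_{1,j,k+1}T_{1,j,k-1}=T_{1,j+1,k}T_{1,j-1,k}+T_{2,j,k},\qquad T_{2,j,k+1}T_{2,j,k-1}=T_{2,j+1,k}T_{2,j-1,k}+T_{1,j,k}$$ on the points $(\alpha,j,k)$, $\alpha\in\{1,2\}$, $\alpha+j+k$ even, with boundary condition $T_{\alpha,j,k_{\alpha,j}}=a_{\alpha,j}$ along an admissible boundary $(k_{\alpha,j})$ (see context), the $T_{\alpha,j,k}$ being viewed as rational functions of the boundary values. Let $(1,j,k)$ satisfy $1+j+k$ even and $k>k_{1,j}$, and set $$j_0=\max\{j'\in\mathbb Z:\ j'-k_{1,j'}=j-k\},\qquad j_1=\min\{j'\in\mathbb Z:\ j'+k_{1,j'}=j+k\}.$$ Then, for any admissible choices of diagonals in the construction of the slice matrices, $$T_{1,j,k}=T_{1,j_1,k_{1,j_1}}\,\big(S_{j_0}S_{j_0+1}\cdots S_{j_1-1}\big)_{1,1}.$$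
   Context: Admissible boundary: integers $k_{\alpha,j}$ ($\alpha\in\{1,2\}$, $j\in\mathbb Z$) with $\alpha+j+k_{\alpha,j}$ even, $|k_{2,j}-k_{1,j}|=1$ and $|k_{\alpha,j+1}-k_{\alpha,j}|=1$ for all $j$, and which agree with the basic staircase up to a global shift outside a finite window: there are an even integer $c$ and integers $J_-\le J_+$ such that $k_{\alpha,j}=c+((\alpha+j)\bmod 2)$ whenever $j<J_-$ or $j>J_+$. Elementary matrices ($3\times 3$, indices $1,2,3$): $H_{\alpha,\alpha+1}(a,b,u)$ is the identity matrix except that its $2\times2$ block in rows/columns $\alpha,\alpha+1$ is $\begin{pmatrix}1&0\\ u/b&a/b\end{pmatrix}$, and $V_{\alpha,\alpha+1}(x,a,b)$ is the identity except that this block is $\begin{pmatrix}a/b&x/b\\ 0&1\end{pmatrix}$. Slice matrix $S_t$ ($t\in\mathbb Z$): put $a_\alpha=T_{\alpha,t,k_{\alpha,t}}$, $b_\alpha=T_{\alpha,t+1,k_{\alpha,t+1}}$ for $\alpha=1,2$, and $a_0=b_0=a_3=b_3=1$. For the square $Q$ with corners $(1,t),(1,t+1),(2,t),(2,t+1)$, a diagonal is admissible if its two endpoints have equal $k$-values: "SW–NE" is $(1,t)$–$(2,t+1)$ (admissible iff $k_{1,t}=k_{2,t+1}$) and "NW–SE" is $(1,t+1)$–$(2,t)$ (admissible iff $k_{1,t+1}=k_{2,t}$); at least one is admissible, and one admissible diagonal is chosen. For $\alpha=1,2$: if $k_{\alpha,t+1}=k_{\alpha,t}+1$, set $X_\alpha=H_{\alpha,\alpha+1}(a_\alpha,b_\alpha,u_\alpha)$,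 where $u_2=1$ and $u_1=b_2$ if $Q$ has the SW–NE diagonal, $u_1=a_2$ if NW–SE; if $k_{\alpha,t+1}=k_{\alpha,t}-1$, set $X_\alpha=V_{\alpha,\alpha+1}(x_\alpha,a_\alpha,b_\alpha)$, where $x_1=1$ and $x_2=a_1$ if $Q$ has the SW–NE diagonal, $x_2=b_1$ if NW–SE. Finally $S_t=X_2X_1$ if the chosen diagonal is SW–NE and $S_t=X_1X_2$ if it is NW–SE. $(M)_{1,1}$ is the top-left entry. -}

module Defs where

open import Level using (Level; _⊔_) renaming (suc to lsuc)
open import Algebra.Bundles using (CommutativeRing)
open import Data.Nat using (ℕ; zero) renaming (suc to sucℕ)
open import Data.Integer using (ℤ; +_; _+_; _-_; ∣_∣; _≤_; _<_; 1ℤ)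
open import Data.Integer.DivMod using (_%ℕ_)
open import Data.Integer.Divisibility using (_∣_)
open import Data.Fin using (Fin; zero; suc)
open import Data.Product using (Σ; _×_; ∃)
open import Data.Sum using (_⊎_)
open import Relation.Nullary using (yes; no)
open import Data.Integer using (_≟_)
open import Relation.Binary.PropositionalEquality using (_≡_)
open import Relation.Nullary using (¬_)

-- Fields (agda-stdlib 2.3 has no Field bundle): a commutative ring with
-- 1 ≠ 0 and a (total) inverse operation that is a genuine inverse on
-- nonzero elements.

record Field (c ℓ : Level) : Set (lsuc (c ⊔ ℓ)) where
  field
    commutativeRing : CommutativeRing c ℓ
  open CommutativeRing commutativeRing public
  field
    _⁻¹       : Carrier → Carrier
    ⁻¹-cong   : ∀ {x y} → x ≈ y → x ⁻¹ ≈ y ⁻¹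
    1≉0       : ¬ (1# ≈ 0#)
    inverseʳ  : ∀ x → ¬ (x ≈ 0#) → x * (x ⁻¹) ≈ 1#

  _/_ : Carrier → Carrier → Carrier
  x / y = x * (y ⁻¹)

data Idx : Set where
  one two : Idx

toℤ : Idx → ℤ
toℤ one = + 1
toℤ two = + 2

other : Idx → Idx
other one = two
other two = one

Even : ℤ → Set
Even z = (+ 2) ∣ z

Boundary : Set
Boundary = Idx → ℤ → ℤ

record Admissible (k : Boundary) : Set where
  field
    parity   : ∀ α j → Even (toℤ α + j + k α j)
    vertical : ∀ j → ∣ k two j - k one j ∣ ≡ 1
    step     : ∀ α j → ∣ k α (j + 1ℤ) - k α j ∣ ≡ 1
    c        : ℤ
    c-even   : Even c
    J₋ J₊    : ℤ
    J₋≤J₊    : J₋ ≤ J₊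
    stair    : ∀ α j → (j < J₋) ⊎ (J₊ < j) →
               k α j ≡ c + + ((toℤ α + j) %ℕ 2)

-- Diagonal choices for the squares Q_t with corners (1,t),(1,t+1),(2,t),(2,t+1)

data Diag : Set where
  swne nwse : Diag

DiagOK : Boundary → ℤ → Diag → Set
DiagOK k t swne = k one t ≡ k two (t + 1ℤ)
DiagOK k t nwse = k one (t + 1ℤ) ≡ k two t

module _ {c ℓ : Level} (F : Field c ℓ) where
  open Field F using (Carrier; _≈_; 0#; 1#; _/_)
    renaming (_+_ to _⊕_; _*_ to _·_)

  -- 3×3 matrices, indices 1,2,3 represented by Fin 3 = 0,1,2
  Mat : Set c
  Mat = Fin 3 → Fin 3 → Carrier

  idMat : Mat
  idMat zero zero = 1#
  idMat (suc zero) (suc zero) = 1#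
  idMat (suc (suc zero)) (suc (suc zero)) = 1#
  idMat _ _ = 0#

  _⊗_ : Mat → Mat → Mat
  (A ⊗ B) i l = A i zero · B zero l ⊕ A i (suc zero) · B (suc zero) l
                ⊕ A i (suc (suc zero)) · B (suc (suc zero)) l

  -- identity matrix except the 2×2 block in rows/columns α, α+1,
  -- which is ( p q ; r s )
  block : Idx → Carrier → Carrier → Carrier → Carrier → Mat
  block one p q r s zero zero = p
  block one p q r s zero (suc zero) = q
  block one p q r s (suc zero) zero = r
  block one p q r s (suc zero) (suc zero) = s
  block one p q r s (suc (suc zero)) (suc (suc zero)) = 1#
  block one p q r s _ _ = 0#
  block two p q r s zero zero = 1#
  block two p q r s (suc zero) (suc zero) = p
  block two p q r s (suc zero) (suc (suc zero)) = q
  block two p q r s (suc (suc zero)) (suc zero) = r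
  block two p q r s (suc (suc zero)) (suc (suc zero)) = s
  block two p q r s _ _ = 0#

  H : Idx → Carrier → Carrier → Carrier → Mat
  H α a b u = block α 1# 0# (u / b) (a / b)

  V : Idx → Carrier → Carrier → Carrier → Mat
  V α x a b = block α (a / b) (x / b) 0# 1#

  Slice : Boundary → (Idx → ℤ → ℤ → Carrier) → (ℤ → Diag) → ℤ → Mat
  Slice k T d t with d t
  ... | swne = X two ⊗ X one
    where
      a b : Idx → Carrier
      a α = T α t (k α t)
      b α = T α (t + 1ℤ) (k α (t + 1ℤ))
      X : Idx → Mat
      X one with k one (t + 1ℤ) ≟ k one t + 1ℤ
      ... | yes _ = H one (a one) (b one) (b two)
      ... | no _  = V one 1# (a one) (b one)
      X two with k two (t + 1ℤ) ≟ k two t + 1ℤ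
      ... | yes _ = H two (a two) (b two) 1#
      ... | no _  = V two (a one) (a two) (b two)
  ... | nwse = X one ⊗ X two
    where
      a b : Idx → Carrier
      a α = T α t (k α t)
      b α = T α (t + 1ℤ) (k α (t + 1ℤ))
      X : Idx → Mat
      X one with k one (t + 1ℤ) ≟ k one t + 1ℤ
      ... | yes _ = H one (a one) (b one) (a two)
      ... | no _  = V one 1# (a one) (b one)
      X two with k two (t + 1ℤ) ≟ k two t + 1ℤ
      ... | yes _ = H two (a two) (b two) 1#
      ... | no _  = V two (b one) (a two) (b two)

  prodFrom : (ℤ → Mat) → ℤ → ℕ → Mat
  prodFrom S t zero = idMat
  prodFrom S t (sucℕ n) = S t ⊗ prodFrom S (t + 1ℤ) n

  -- T solves the A₂ T-system above the boundary k (with the boundary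
  -- values T_{α,j,k_{α,j}} as initial data): every equation centred at
  -- (α,j,k') (α+j+k' odd) whose lowest point (α,j,k'-1) lies on or above
  -- the boundary holds.
  IsTSolution : Boundary → (Idx → ℤ → ℤ → Carrier) → Set ℓ
  IsTSolution k T = ∀ α j k' → Even (toℤ α + j + k' + 1ℤ) → k α j < k' →
    T α j (k' + 1ℤ) · T α j (k' - 1ℤ)
      ≈ T α (j + 1ℤ) k' · T α (j - 1ℤ) k' ⊕ T (other α) j k'

  -- all values on or above the boundary are nonzero (as the rational
  -- functions of the boundary values are)
  NonzeroAbove : Boundary → (Idx → ℤ → ℤ → Carrier) → Set ℓ
  NonzeroAbove k T = ∀ α j k' → Even (toℤ α + j + k') → k α j ≤ k' →
    ¬ (T α j k' ≈ 0#)

module Submission where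

-- The columns j₀ < j < j₁ of the theorem are the ends of the backward light
-- cone of (1, j, kk) on row one of the boundary; `Cone.Window` records this
-- situation.  The formula is proved for every boundary in this situation, by
-- induction on the distance μ of the boundary below height kk over the
-- initial window:
--   * a lowest point (β, t) strictly inside the window is a local minimum;
--   * if its height m has kk ≤ m + 2, the window is (j - 1, j + 1) around the
--     apex (1, j, kk - 2), and the formula is the T-system equation at
--     (1, j, kk - 1) in the guise of the 2 × 2 exchange relation
--       V(x, a, c) H(c, b, u) = H(a, c′, u) V(x, c′, b)   (c c′ = a b + x u);
--   * otherwise raising the boundary by 2 at (β, t) changes only the slices
--     S_{t-1}, S_t, and the same exchange relation preserves their product;
--     the window stays or loses its first or last column, whose new slice has
--     a trivial first row, resp. contributes c′/b to the corner entry.  Since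
--     μ drops by 2, the induction hypothesis applies to the raised boundary.
-- Both admissible diagonals of a square give the same slice, so the induction
-- may range over all admissible diagonal choices.

open import Defs
open import Level using (Level)
open import Data.Integer using (ℤ; +_; _+_; _-_; ∣_∣; _≤_; _<_; 1ℤ)
open import Data.Fin using (zero)
open import Relation.Binary.PropositionalEquality using (_≡_)

import Data.Integer as Z
import Data.Integer.Properties as ZP
import Data.Integer.Divisibility.Signed as ZDiv
open import Data.Integer.DivMod using (_%ℕ_)
open import Data.Integer.Tactic.RingSolver using (solve-∀)
import Data.Nat as N
import Data.Nat.Properties as NP
import Data.Nat.Tactic.RingSolver as NS
open import Data.Fin using (suc)
open import Data.Bool using (Bool; true; false)
open import Data.Sum using (_⊎_; inj₁; inj₂)
open import Data.Product using (Σ; _×_; _,_; proj₁; proj₂)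
open import Data.Empty using (⊥-elim)
open import Relation.Nullary using (¬_; Dec; yes; no; does)
open import Relation.Nullary.Decidable using (dec-true; dec-false)
open import Relation.Binary.PropositionalEquality
  using (_≢_; refl; cong; cong₂; subst; subst₂; sym; trans; module ≡-Reasoning)
import Relation.Binary.Reasoning.Setoid as SetoidReasoning

suc-pred : ∀ a → a - 1ℤ + 1ℤ ≡ a
suc-pred = solve-∀

pred-suc : ∀ a → a + 1ℤ - 1ℤ ≡ a
pred-suc = solve-∀

<-suc : ∀ a → a < a + 1ℤ
<-suc a = ZP.suc[i]≤j⇒i<j (ZP.≤-reflexive (ZP.+-comm 1ℤ a))

pred-< : ∀ a → a - 1ℤ < a
pred-< a = subst (a - 1ℤ <_) (suc-pred a) (<-suc (a - 1ℤ))

<⇒suc≤ : ∀ {a b} → a < b → a + 1ℤ ≤ b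
<⇒suc≤ {a} a<b = subst (_≤ _) (ZP.+-comm 1ℤ a) (ZP.i<j⇒suc[i]≤j a<b)

suc≤⇒< : ∀ {a b} → a + 1ℤ ≤ b → a < b
suc≤⇒< {a} a+1≤b = ZP.suc[i]≤j⇒i<j (subst (_≤ _) (ZP.+-comm a 1ℤ) a+1≤b)

<⇒≤pred : ∀ {a b} → a < b → a ≤ b - 1ℤ
<⇒≤pred {a} a<b = subst (_≤ _) (pred-suc a) (ZP.+-monoˡ-≤ (Z.- 1ℤ) (<⇒suc≤ a<b))

<-irrefl : ∀ {a} → ¬ (a < a)
<-irrefl = ZP.<-irrefl refl

suc≢ : ∀ a → a + 1ℤ ≢ a
suc≢ a e = <-irrefl (subst (a <_) e (<-suc a))

pred≢ : ∀ a → a - 1ℤ ≢ a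
pred≢ a e = <-irrefl (subst (_< a) e (pred-< a))

≢pred⇒suc≢ : ∀ {s t} → s ≢ t - 1ℤ → s + 1ℤ ≢ t
≢pred⇒suc≢ {s} s≢t-1 s+1≡t = s≢t-1 (trans (sym (pred-suc s)) (cong (_- 1ℤ) s+1≡t))

up≢down : ∀ x → x + 1ℤ ≢ x - 1ℤ
up≢down x x+1≡x-1 = <-irrefl (ZP.<-trans (subst (_< x) (sym x+1≡x-1) (pred-< x)) (<-suc x))

≤-split : ∀ {a b} → a ≤ b → (a ≡ b) ⊎ (a + 1ℤ ≤ b)
≤-split {a} {b} a≤b with a Z.≟ b
... | yes a≡b = inj₁ a≡b
... | no  a≢b = inj₂ (<⇒suc≤ (ZP.≤∧≢⇒< a≤b a≢b))

+-diff : ∀ a b → b ≡ a + (b - a)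
+-diff = solve-∀

0≤⇒≡+∣-∣ : ∀ {x} → + 0 ≤ x → x ≡ + ∣ x ∣
0≤⇒≡+∣-∣ {+ _} _ = refl

≤⇒≡+∣-∣ : ∀ {a b} → a ≤ b → b ≡ a + + ∣ b - a ∣
≤⇒≡+∣-∣ {a} {b} a≤b = trans (+-diff a b) (cong (λ w → a + w) (0≤⇒≡+∣-∣ (ZP.i≤j⇒0≤j-i a≤b)))

+-injectiveʳ : ∀ a {n m} → a + + n ≡ a + + m → n ≡ m
+-injectiveʳ a {n} {m} a+n≡a+m = ZP.+-injective (begin
  + n            ≡⟨ sym (cancel a (+ n)) ⟩
  a + + n - a    ≡⟨ cong (_- a) a+n≡a+m ⟩
  a + + m - a    ≡⟨ cancel a (+ m) ⟩
  + m            ∎)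
  where
  open ≡-Reasoning
  cancel : ∀ a x → a + x - a ≡ x
  cancel = solve-∀

+-suc-+ : ∀ a n → a + 1ℤ + + n ≡ a + + N.suc n
+-suc-+ a n = ZP.+-assoc a 1ℤ (+ n)

even+2 : ∀ {z} → Even z → Even (z + + 2)
even+2 {z} 2∣z = ZDiv.∣⇒∣ᵤ (ZDiv.∣m∣n⇒∣m+n (ZDiv.∣ᵤ⇒∣ {+ 2} {z} 2∣z) (ZDiv.∣-refl {+ 2}))

data Step (y x : ℤ) : Set where
  up   : y ≡ x + 1ℤ → Step y x
  down : y ≡ x - 1ℤ → Step y x

step-sym : ∀ {y x} → Step y x → Step x y
step-sym {x = x} (up refl)   = down (sym (pred-suc x))
step-sym {x = x} (down refl) = up (sym (suc-pred x))

step-up : ∀ {y x} → Step y x → x ≤ y → y ≡ x + 1ℤ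
step-up (up y≡)           _   = y≡
step-up {x = x} (down refl) x≤y = ⊥-elim (ZP.≤⇒≯ x≤y (pred-< x))

step-notUp : ∀ {y x} → Step y x → y ≢ x + 1ℤ → y ≡ x - 1ℤ
step-notUp (up y≡)   y≢ = ⊥-elim (y≢ y≡)
step-notUp (down y≡) _  = y≡

step-≥ : ∀ {y x} → Step y x → x - 1ℤ ≤ y
step-≥ {x = x} (up refl)   = ZP.<⇒≤ (ZP.<-trans (pred-< x) (<-suc x))
step-≥         (down refl) = ZP.≤-refl

step-≤ : ∀ {y x} → Step y x → y ≤ x + 1ℤ
step-≤         (up refl)   = ZP.≤-refl
step-≤ {x = x} (down refl) = ZP.<⇒≤ (ZP.<-trans (pred-< x) (<-suc x))

∣-∣≡1⇒step : ∀ {y x} → ∣ y - x ∣ ≡ 1 → Step y x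
∣-∣≡1⇒step {y} {x} ∣y-x∣≡1 = byDifference (y - x) refl ∣y-x∣≡1
  where
  byDifference : ∀ z → y - x ≡ z → ∣ z ∣ ≡ 1 → Step y x
  byDifference (+ 1)       y-x≡ _ = up   (trans (+-diff x y) (cong (λ w → x + w) y-x≡))
  byDifference Z.-[1+ 0 ]  y-x≡ _ = down (trans (+-diff x y) (cong (λ w → x + w) y-x≡))
  byDifference (+ 0)             _ ()
  byDifference (+ N.suc (N.suc _)) _ ()
  byDifference Z.-[1+ N.suc _ ]    _ ()

step⇒∣-∣≡1 : ∀ {y x} → Step y x → ∣ y - x ∣ ≡ 1
step⇒∣-∣≡1 {x = x} (up refl)   = cong ∣_∣ (+1-diff x)
  where
  +1-diff : ∀ x → x + 1ℤ - x ≡ 1ℤ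
  +1-diff = solve-∀
step⇒∣-∣≡1 {x = x} (down refl) = cong ∣_∣ (-1-diff x)
  where
  -1-diff : ∀ x → x - 1ℤ - x ≡ Z.- 1ℤ
  -1-diff = solve-∀

module _ {k : Boundary} (adm : Admissible k) where

  vertical-step : ∀ s → Step (k two s) (k one s)
  vertical-step s = ∣-∣≡1⇒step (Admissible.vertical adm s)

  other-step : ∀ β s → Step (k (other β) s) (k β s)
  other-step one s = vertical-step s
  other-step two s = step-sym (vertical-step s)

  right-step : ∀ α s → Step (k α (s + 1ℤ)) (k α s)
  right-step α s = ∣-∣≡1⇒step (Admissible.step adm α s)

  left-step : ∀ α s → Step (k α (s - 1ℤ)) (k α s)
  left-step α s = step-sym (subst (λ s′ → Step (k α s′) (k α (s - 1ℤ))) (suc-pred s) (right-step α (s - 1ℤ)))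

  parity+2 : ∀ α s → Even (toℤ α + s + (k α s + + 2))
  parity+2 α s = subst Even (ZP.+-assoc (toℤ α + s) (k α s) (+ 2)) (even+2 {toℤ α + s + k α s} (Admissible.parity adm α s))

-- Raising a boundary by 2 at one point (the combinatorial mutation)

_≟ᵢ_ : (α β : Idx) → Dec (α ≡ β)
one ≟ᵢ one = yes refl
one ≟ᵢ two = no λ ()
two ≟ᵢ one = no λ ()
two ≟ᵢ two = yes refl

raise : Boundary → Idx → ℤ → Boundary
raise k β t α s with α ≟ᵢ β | s Z.≟ t
... | yes _ | yes _ = k α s + + 2
... | _     | _     = k α s

raise-at : ∀ k β t → raise k β t β t ≡ k β t + + 2
raise-at k β t with β ≟ᵢ β | t Z.≟ t
... | yes _ | yes _  = refl
... | no β≢β | _     = ⊥-elim (β≢β refl)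
... | yes _ | no t≢t = ⊥-elim (t≢t refl)

raise-off : ∀ k β t α s → s ≢ t → raise k β t α s ≡ k α s
raise-off k β t α s s≢t with α ≟ᵢ β | s Z.≟ t
... | yes _ | yes s≡t = ⊥-elim (s≢t s≡t)
... | yes _ | no _    = refl
... | no _  | _       = refl

raise-offRow : ∀ k β t α s → α ≢ β → raise k β t α s ≡ k α s
raise-offRow k β t α s α≢β with α ≟ᵢ β
... | yes α≡β = ⊥-elim (α≢β α≡β)
... | no _    = refl

data RaiseView (k : Boundary) (β : Idx) (t : ℤ) (α : Idx) (s : ℤ) : Set where
  centre : α ≡ β → s ≡ t → RaiseView k β t α s
  away   : raise k β t α s ≡ k α s → RaiseView k β t α s

raise-view : ∀ k β t α s → RaiseView k β t α s
raise-view k β t α s with α ≟ᵢ β | s Z.≟ t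
... | yes α≡β | yes s≡t = centre α≡β s≡t
... | yes _   | no s≢t  = away (raise-off k β t α s s≢t)
... | no α≢β  | _       = away (raise-offRow k β t α s α≢β)

raise-≥ : ∀ k β t α s → k α s ≤ raise k β t α s
raise-≥ k β t α s with raise-view k β t α s
... | centre refl refl = subst (k α s ≤_) (sym (raise-at k α s)) (ZP.i≤i+j (k α s) (+ 2))
... | away e           = ZP.≤-reflexive (sym e)

record LocalMin (k : Boundary) (β : Idx) (t : ℤ) : Set where
  field
    above : k (other β) t ≡ k β t + 1ℤ
    right : k β (t + 1ℤ) ≡ k β t + 1ℤ
    left  : k β (t - 1ℤ) ≡ k β t + 1ℤ

+2-1 : ∀ m → m + 1ℤ ≡ m + + 2 - 1ℤ
+2-1 = solve-∀

+1+1 : ∀ m → m + + 2 ≡ m + 1ℤ + 1ℤ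
+1+1 = solve-∀

module _ {k : Boundary} (adm : Admissible k) {β : Idx} {t : ℤ} (lm : LocalMin k β t) where
  private
    k′ : Boundary
    k′ = raise k β t
    open LocalMin lm

  raise-vertical : ∀ s → Step (k′ two s) (k′ one s)
  raise-vertical s with raise-view k β t one s | raise-view k β t two s
  ... | centre refl _ | centre () _
  ... | centre refl refl | away e = down (begin
    k′ two t          ≡⟨ trans e above ⟩
    k one t + 1ℤ      ≡⟨ +2-1 (k one t) ⟩
    k one t + + 2 - 1ℤ ≡⟨ cong (_- 1ℤ) (sym (raise-at k one t)) ⟩
    k′ one t - 1ℤ     ∎)
    where open ≡-Reasoning
  ... | away e | centre refl refl = up (begin
    k′ two t          ≡⟨ raise-at k two t ⟩
    k two t + + 2      ≡⟨ +1+1 (k two t) ⟩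
    k two t + 1ℤ + 1ℤ ≡⟨ cong (_+ 1ℤ) (sym (trans e above)) ⟩
    k′ one t + 1ℤ     ∎)
    where open ≡-Reasoning
  ... | away e₁ | away e₂ = subst₂ Step (sym e₂) (sym e₁) (vertical-step adm s)

  raise-horizontal : ∀ α s → Step (k′ α (s + 1ℤ)) (k′ α s)
  raise-horizontal α s with raise-view k β t α s | raise-view k β t α (s + 1ℤ)
  ... | centre _ refl | centre _ s+1≡s = ⊥-elim (suc≢ s s+1≡s)
  ... | centre refl refl | away e = down (begin
    k′ β (t + 1ℤ)      ≡⟨ trans e right ⟩
    k β t + 1ℤ         ≡⟨ +2-1 (k β t) ⟩
    k β t + + 2 - 1ℤ    ≡⟨ cong (_- 1ℤ) (sym (raise-at k β t)) ⟩
    k′ β t - 1ℤ        ∎)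
    where open ≡-Reasoning
  ... | away e | centre refl s+1≡t = up (begin
    k′ β (s + 1ℤ)      ≡⟨ cong (k′ β) s+1≡t ⟩
    k′ β t             ≡⟨ raise-at k β t ⟩
    k β t + + 2         ≡⟨ +1+1 (k β t) ⟩
    k β t + 1ℤ + 1ℤ    ≡⟨ cong (_+ 1ℤ) (sym left) ⟩
    k β (t - 1ℤ) + 1ℤ  ≡⟨ cong (λ s′ → k β s′ + 1ℤ) (sym s≡t-1) ⟩
    k β s + 1ℤ         ≡⟨ cong (_+ 1ℤ) (sym e) ⟩
    k′ β s + 1ℤ        ∎)
    where
    open ≡-Reasoning
    s≡t-1 : s ≡ t - 1ℤ
    s≡t-1 = trans (sym (pred-suc s)) (cong (_- 1ℤ) s+1≡t)
  ... | away e₁ | away e₂ = subst₂ Step (sym e₂) (sym e₁) (right-step adm α s)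

  raise-parity : ∀ α s → Even (toℤ α + s + k′ α s)
  raise-parity α s with raise-view k β t α s
  ... | centre refl refl = subst (λ w → Even (toℤ α + s + w)) (sym (raise-at k α s)) (parity+2 adm α s)
  ... | away e = subst (λ w → Even (toℤ α + s + w)) (sym e) (Admissible.parity adm α s)

  raise-admissible : Admissible k′
  raise-admissible = record
    { parity   = raise-parity
    ; vertical = λ s → step⇒∣-∣≡1 (raise-vertical s)
    ; step     = λ α s → step⇒∣-∣≡1 (raise-horizontal α s)
    ; c        = c
    ; c-even   = c-even
    ; J₋       = J₋ Z.⊓ t
    ; J₊       = J₊ Z.⊔ t
    ; J₋≤J₊    = ZP.≤-trans (ZP.i⊓j≤i J₋ t) (ZP.≤-trans J₋≤J₊ (ZP.i≤i⊔j J₊ t))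
    ; stair    = stair′
    }
    where
    open Admissible adm
    stair′ : ∀ α s → (s < J₋ Z.⊓ t) ⊎ (J₊ Z.⊔ t < s) → k′ α s ≡ c + + ((toℤ α + s) %ℕ 2)
    stair′ α s (inj₁ s<) = trans (raise-off k β t α s (ZP.<⇒≢ (ZP.<-≤-trans s< (ZP.i⊓j≤j J₋ t))))
                                 (stair α s (inj₁ (ZP.<-≤-trans s< (ZP.i⊓j≤i J₋ t))))
    stair′ α s (inj₂ <s) = trans (raise-off k β t α s (λ s≡t → ZP.<⇒≢ (ZP.≤-<-trans (ZP.i≤j⊔i J₊ t) <s) (sym s≡t)))
                                 (stair α s (inj₂ (ZP.≤-<-trans (ZP.i≤i⊔j J₊ t) <s)))

window-split : ∀ {a s} n → a ≤ s → s < a + + N.suc n →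
               (s ≡ a) ⊎ (a + 1ℤ ≤ s × s < a + 1ℤ + + n)
window-split {a} {s} n a≤s s< with ≤-split a≤s
... | inj₁ a≡s   = inj₁ (sym a≡s)
... | inj₂ a+1≤s = inj₂ (a+1≤s , subst (s <_) (sym (+-suc-+ a n)) s<)

record WindowMin (k : Boundary) (a : ℤ) (n : N.ℕ) : Set where
  field
    β       : Idx
    t       : ℤ
    a≤t     : a ≤ t
    t<a+n   : t < a + + n
    minimal : ∀ α s → a ≤ s → s < a + + n → k β t ≤ k α s

lower-row : ∀ (k : Boundary) s → Σ Idx (λ β → ∀ α → k β s ≤ k α s)
lower-row k s with k one s ZP.≤? k two s
... | yes k₁≤k₂ = one , λ { one → ZP.≤-refl ; two → k₁≤k₂ }
... | no  k₁≰k₂ = two , λ { one → ZP.<⇒≤ (ZP.≰⇒> k₁≰k₂) ; two → ZP.≤-refl }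

<-+suc : ∀ a m → a < a + + N.suc m
<-+suc a m = ZP.<-≤-trans (<-suc a) (ZP.+-monoʳ-≤ a (Z.+≤+ (N.s≤s N.z≤n)))

window-min : ∀ k a n → WindowMin k a (N.suc n)
window-min k a N.zero = record
  { β = β₀ ; t = a ; a≤t = ZP.≤-refl ; t<a+n = <-suc a ; minimal = minimal }
  where
  β₀ : Idx
  β₀ = proj₁ (lower-row k a)
  minimal : ∀ α s → a ≤ s → s < a + + 1 → k β₀ a ≤ k α s
  minimal α s a≤s s< with window-split 0 a≤s s<
  ... | inj₁ refl = proj₂ (lower-row k a) α
  ... | inj₂ (a+1≤s , s<) = ⊥-elim (ZP.≤⇒≯ a+1≤s (subst (s <_) (ZP.+-identityʳ (a + 1ℤ)) s<))
window-min k a (N.suc n) with window-min k (a + 1ℤ) n | lower-row k a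
... | rest | (β₀ , β₀-min) with k β₀ a ZP.≤? k (WindowMin.β rest) (WindowMin.t rest)
...   | yes column-lower = record
  { β = β₀ ; t = a ; a≤t = ZP.≤-refl ; t<a+n = <-+suc a (N.suc n) ; minimal = minimal }
  where
  minimal : ∀ α s → a ≤ s → s < a + + N.suc (N.suc n) → k β₀ a ≤ k α s
  minimal α s a≤s s< with window-split (N.suc n) a≤s s<
  ... | inj₁ refl      = β₀-min α
  ... | inj₂ (a+1≤s , s<′) = ZP.≤-trans column-lower (WindowMin.minimal rest α s a+1≤s s<′)
...   | no column-higher = record
  { β = WindowMin.β rest ; t = WindowMin.t rest
  ; a≤t = ZP.≤-trans (ZP.<⇒≤ (<-suc a)) (WindowMin.a≤t rest)
  ; t<a+n = subst (WindowMin.t rest <_) (+-suc-+ a (N.suc n)) (WindowMin.t<a+n rest)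
  ; minimal = minimal }
  where
  minimal : ∀ α s → a ≤ s → s < a + + N.suc (N.suc n) → k (WindowMin.β rest) (WindowMin.t rest) ≤ k α s
  minimal α s a≤s s< with window-split (N.suc n) a≤s s<
  ... | inj₁ refl      = ZP.≤-trans (ZP.<⇒≤ (ZP.≰⇒> column-higher)) (β₀-min α)
  ... | inj₂ (a+1≤s , s<′) = WindowMin.minimal rest α s a+1≤s s<′

+2-swap : ∀ a b → a N.+ b N.+ 2 ≡ a N.+ 2 N.+ b
+2-swap = NS.solve-∀

sumFrom : (ℤ → N.ℕ) → ℤ → N.ℕ → N.ℕ
sumFrom f a N.zero    = 0
sumFrom f a (N.suc n) = f a N.+ sumFrom f (a + 1ℤ) n

sumFrom-cong : ∀ {f g} a n → (∀ s → a ≤ s → f s ≡ g s) → sumFrom f a n ≡ sumFrom g a n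
sumFrom-cong a N.zero    f≡g = refl
sumFrom-cong a (N.suc n) f≡g =
  cong₂ N._+_ (f≡g a ZP.≤-refl) (sumFrom-cong (a + 1ℤ) n (λ s a+1≤s → f≡g s (ZP.≤-trans (ZP.<⇒≤ (<-suc a)) a+1≤s)))

sumFrom-lower : ∀ {f g} t a n → (∀ s → s ≢ t → g s ≡ f s) → g t N.+ 2 ≡ f t →
                a ≤ t → t < a + + n → sumFrom g a n N.+ 2 ≡ sumFrom f a n
sumFrom-lower t a N.zero _ _ a≤t t< = ⊥-elim (ZP.≤⇒≯ a≤t (subst (t <_) (ZP.+-identityʳ a) t<))
sumFrom-lower {f} {g} t a (N.suc n) off at a≤t t< with window-split n a≤t t<
... | inj₁ refl = begin
  g t N.+ sumFrom g (t + 1ℤ) n N.+ 2   ≡⟨ cong (λ r → g t N.+ r N.+ 2) rest ⟩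
  g t N.+ sumFrom f (t + 1ℤ) n N.+ 2   ≡⟨ +2-swap (g t) _ ⟩
  g t N.+ 2 N.+ sumFrom f (t + 1ℤ) n   ≡⟨ cong (N._+ sumFrom f (t + 1ℤ) n) at ⟩
  f t N.+ sumFrom f (t + 1ℤ) n         ∎
  where
  open ≡-Reasoning
  rest : sumFrom g (t + 1ℤ) n ≡ sumFrom f (t + 1ℤ) n
  rest = sumFrom-cong (t + 1ℤ) n λ s t+1≤s → off s λ s≡t → <-irrefl (ZP.<-≤-trans (<-suc t) (subst (t + 1ℤ ≤_) s≡t t+1≤s))
... | inj₂ (a+1≤t , t<′) = begin
  g a N.+ sumFrom g (a + 1ℤ) n N.+ 2   ≡⟨ NP.+-assoc (g a) _ 2 ⟩
  g a N.+ (sumFrom g (a + 1ℤ) n N.+ 2) ≡⟨ cong₂ N._+_ (off a a≢t) (sumFrom-lower t (a + 1ℤ) n off at a+1≤t t<′) ⟩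
  f a N.+ sumFrom f (a + 1ℤ) n         ∎
  where
  open ≡-Reasoning
  a≢t : a ≢ t
  a≢t a≡t = <-irrefl (ZP.<-≤-trans (<-suc a) (subst (a + 1ℤ ≤_) (sym a≡t) a+1≤t))

step-mono : ∀ (f : ℤ → ℤ) → (∀ s → f s ≤ f (s + 1ℤ)) → ∀ {a b} → a ≤ b → f a ≤ f b
step-mono f f-step {a} {b} a≤b = subst (λ b′ → f a ≤ f b′) (sym (≤⇒≡+∣-∣ a≤b)) (from a ∣ b - a ∣)
  where
  from : ∀ a n → f a ≤ f (a + + n)
  from a N.zero    = ZP.≤-reflexive (cong f (sym (ZP.+-identityʳ a)))
  from a (N.suc n) = ZP.≤-trans (f-step a) (subst (λ b′ → f (a + 1ℤ) ≤ f b′) (+-suc-+ a n) (from (a + 1ℤ) n))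

-- The light cone of the point (1, j, kk) on a boundary
--
-- Fix the point (1, j, kk) and an ambient window [A, A + W) of columns.
-- `Window k j₀ j₁ n` says that on the boundary k the backward light cone
-- of (1, j, kk) meets row 1 exactly at the columns j₀ < j < j₁ = j₀ + n,
-- and that row 1 descends into the cone at both ends.

module Cone (j kk A : ℤ) (W : N.ℕ) where

  record Window (k : Boundary) (j₀ j₁ : ℤ) (n : N.ℕ) : Set where
    field
      admissible     : Admissible k
      length         : j₁ ≡ j₀ + + n
      left-end       : j₀ - k one j₀ ≡ j - kk
      right-end      : j₁ + k one j₁ ≡ j + kk
      left-descends  : k one (j₀ + 1ℤ) ≡ k one j₀ - 1ℤ
      right-descends : k one (j₁ - 1ℤ) ≡ k one j₁ - 1ℤ
      j₀<j           : j₀ < j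
      j<j₁           : j < j₁
      A≤j₀           : A ≤ j₀
      j₁≤A+W         : j₁ ≤ A + + W

  μ : Boundary → N.ℕ
  μ k = sumFrom (λ s → ∣ kk - k one s ∣ N.+ ∣ kk - k two s ∣) A W

  μ-raise : ∀ k β t → A ≤ t → t < A + + W → k β t + + 2 ≤ kk → μ (raise k β t) N.+ 2 ≡ μ k
  μ-raise k β t A≤t t< below = sumFrom-lower t A W off (at β below) A≤t t<
    where
    off : ∀ s → s ≢ t → ∣ kk - raise k β t one s ∣ N.+ ∣ kk - raise k β t two s ∣ ≡ ∣ kk - k one s ∣ N.+ ∣ kk - k two s ∣
    off s s≢t = cong₂ (λ x y → ∣ kk - x ∣ N.+ ∣ kk - y ∣) (raise-off k β t one s s≢t) (raise-off k β t two s s≢t)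
    closer : ∀ m → m + + 2 ≤ kk → ∣ kk - (m + + 2) ∣ N.+ 2 ≡ ∣ kk - m ∣
    closer m m+2≤kk = sym (begin
      ∣ kk - m ∣                      ≡⟨ cong ∣_∣ (shift kk m) ⟩
      ∣ kk - (m + + 2) + + 2 ∣         ≡⟨ cong (λ x → ∣ x + + 2 ∣) (0≤⇒≡+∣-∣ (ZP.i≤j⇒0≤j-i m+2≤kk)) ⟩
      ∣ kk - (m + + 2) ∣ N.+ 2         ∎)
      where
      open ≡-Reasoning
      shift : ∀ kk m → kk - m ≡ kk - (m + + 2) + + 2
      shift = solve-∀
    at : ∀ β → k β t + + 2 ≤ kk →
         ∣ kk - raise k β t one t ∣ N.+ ∣ kk - raise k β t two t ∣ N.+ 2 ≡ ∣ kk - k one t ∣ N.+ ∣ kk - k two t ∣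
    at one below = begin
      ∣ kk - raise k one t one t ∣ N.+ ∣ kk - raise k one t two t ∣ N.+ 2
        ≡⟨ cong₂ (λ x y → ∣ kk - x ∣ N.+ ∣ kk - y ∣ N.+ 2) (raise-at k one t) (raise-offRow k one t two t λ ()) ⟩
      ∣ kk - (k one t + + 2) ∣ N.+ ∣ kk - k two t ∣ N.+ 2
        ≡⟨ +2-swap ∣ kk - (k one t + + 2) ∣ ∣ kk - k two t ∣ ⟩
      ∣ kk - (k one t + + 2) ∣ N.+ 2 N.+ ∣ kk - k two t ∣
        ≡⟨ cong (N._+ ∣ kk - k two t ∣) (closer (k one t) below) ⟩
      ∣ kk - k one t ∣ N.+ ∣ kk - k two t ∣ ∎
      where open ≡-Reasoning
    at two below = begin
      ∣ kk - raise k two t one t ∣ N.+ ∣ kk - raise k two t two t ∣ N.+ 2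
        ≡⟨ cong₂ (λ x y → ∣ kk - x ∣ N.+ ∣ kk - y ∣ N.+ 2) (raise-offRow k two t one t λ ()) (raise-at k two t) ⟩
      ∣ kk - k one t ∣ N.+ ∣ kk - (k two t + + 2) ∣ N.+ 2
        ≡⟨ NP.+-assoc ∣ kk - k one t ∣ _ 2 ⟩
      ∣ kk - k one t ∣ N.+ (∣ kk - (k two t + + 2) ∣ N.+ 2)
        ≡⟨ cong (∣ kk - k one t ∣ N.+_) (closer (k two t) below) ⟩
      ∣ kk - k one t ∣ N.+ ∣ kk - k two t ∣ ∎
      where open ≡-Reasoning

  LowerBound : Boundary → ℤ → ℤ → ℤ → Set
  LowerBound k j₀ j₁ m = ∀ α s → j₀ + 1ℤ ≤ s → s < j₁ → m ≤ k α s

  module WindowFacts {k j₀ j₁ n} (w : Window k j₀ j₁ n) where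
    open Window w

    k-left : k one j₀ ≡ j₀ - j + kk
    k-left = trans (reorder j₀ (k one j₀)) (trans (cong (j₀ -_) left-end) (assoc j₀ j kk))
      where
      reorder : ∀ a x → x ≡ a - (a - x)
      reorder = solve-∀
      assoc : ∀ a j kk → a - (j - kk) ≡ a - j + kk
      assoc = solve-∀

    k-right : k one j₁ ≡ j + kk - j₁
    k-right = trans (reorder j₁ (k one j₁)) (cong (_- j₁) right-end)
      where
      reorder : ∀ a x → x ≡ a + x - a
      reorder = solve-∀

    j₀+1≤j : j₀ + 1ℤ ≤ j
    j₀+1≤j = <⇒suc≤ j₀<j

    j≤j₁-1 : j ≤ j₁ - 1ℤ
    j≤j₁-1 = <⇒≤pred j<j₁

    k-left-inner : k one (j₀ + 1ℤ) ≡ j₀ - j + kk - 1ℤ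
    k-left-inner = trans left-descends (cong (_- 1ℤ) k-left)

    k-right-inner : k one (j₁ - 1ℤ) ≡ j + kk - j₁ - 1ℤ
    k-right-inner = trans right-descends (cong (_- 1ℤ) k-right)

    apex-left : j ≡ j₀ + 1ℤ → k one (j₀ + 1ℤ) + + 2 ≡ kk
    apex-left j≡ = begin
      k one (j₀ + 1ℤ) + + 2               ≡⟨ cong (_+ + 2) k-left-inner ⟩
      j₀ - j + kk - 1ℤ + + 2              ≡⟨ cong (λ x → j₀ - x + kk - 1ℤ + + 2) j≡ ⟩
      j₀ - (j₀ + 1ℤ) + kk - 1ℤ + + 2      ≡⟨ simplify j₀ kk ⟩
      kk                                 ∎
      where
      open ≡-Reasoning
      simplify : ∀ a kk → a - (a + 1ℤ) + kk - 1ℤ + + 2 ≡ kk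
      simplify = solve-∀

    apex-right : j₁ ≡ j + 1ℤ → k one (j₁ - 1ℤ) + + 2 ≡ kk
    apex-right j₁≡ = begin
      k one (j₁ - 1ℤ) + + 2               ≡⟨ cong (_+ + 2) k-right-inner ⟩
      j + kk - j₁ - 1ℤ + + 2              ≡⟨ cong (λ x → j + kk - x - 1ℤ + + 2) j₁≡ ⟩
      j + kk - (j + 1ℤ) - 1ℤ + + 2        ≡⟨ simplify j kk ⟩
      kk                                 ∎
      where
      open ≡-Reasoning
      simplify : ∀ a kk → a + kk - (a + 1ℤ) - 1ℤ + + 2 ≡ kk
      simplify = solve-∀

    below-column : ∀ {m s} → m ≤ k one s - 1ℤ → ∀ α → m ≤ k α s
    below-column m≤ one = ZP.≤-trans m≤ (ZP.<⇒≤ (pred-< _))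
    below-column {s = s} m≤ two = ZP.≤-trans m≤ (step-≥ (vertical-step admissible s))

    bound-closed : ∀ {m} → LowerBound k j₀ j₁ m → ∀ α s → j₀ ≤ s → s ≤ j₁ → m ≤ k α s
    bound-closed {m} bound α s j₀≤s s≤j₁ with ≤-split j₀≤s
    ... | inj₁ refl = below-column (subst (m ≤_) left-descends (bound one (j₀ + 1ℤ) ZP.≤-refl j₀+1<j₁)) α
      where
      j₀+1<j₁ : j₀ + 1ℤ < j₁
      j₀+1<j₁ = ZP.≤-<-trans j₀+1≤j j<j₁
    ... | inj₂ j₀+1≤s with s Z.≟ j₁
    ...   | no s≢j₁   = bound α s j₀+1≤s (ZP.≤∧≢⇒< s≤j₁ s≢j₁)
    ...   | yes refl  = below-column (subst (m ≤_) right-descends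
                           (bound one (s - 1ℤ) (ZP.≤-trans j₀+1≤j j≤j₁-1) (pred-< s))) α

    interior-min-local : ∀ β t → j₀ + 1ℤ ≤ t → t < j₁ → LowerBound k j₀ j₁ (k β t) → LocalMin k β t
    interior-min-local β t j₀+1≤t t<j₁ bound = record
      { above = step-up (other-step admissible β t) (closed (other β) t j₀≤t (ZP.<⇒≤ t<j₁))
      ; right = step-up (right-step admissible β t)
                        (closed β (t + 1ℤ) (ZP.≤-trans j₀≤t (ZP.<⇒≤ (<-suc t))) (<⇒suc≤ t<j₁))
      ; left  = step-up (left-step admissible β t)
                        (closed β (t - 1ℤ) (<⇒≤pred (suc≤⇒< j₀+1≤t)) (ZP.≤-trans (ZP.<⇒≤ (pred-< t)) (ZP.<⇒≤ t<j₁)))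
      }
      where
      closed : ∀ α s → j₀ ≤ s → s ≤ j₁ → k β t ≤ k α s
      closed = bound-closed bound
      j₀≤t : j₀ ≤ t
      j₀≤t = ZP.≤-trans (ZP.<⇒≤ (<-suc j₀)) j₀+1≤t

    narrow-left : kk ≤ k one (j₀ + 1ℤ) + + 2 → j ≡ j₀ + 1ℤ
    narrow-left kk≤ = ZP.≤-antisym (subst₂ _≤_ (cancel kk j) (shift j₀ j kk)
                                     (ZP.+-monoˡ-≤ (j - kk) (subst (λ x → kk ≤ x + + 2) k-left-inner kk≤))) j₀+1≤j
      where
      cancel : ∀ kk j → kk + (j - kk) ≡ j
      cancel = solve-∀
      shift : ∀ a j kk → a - j + kk - 1ℤ + + 2 + (j - kk) ≡ a + 1ℤ
      shift = solve-∀

    narrow-right : kk ≤ k one (j₁ - 1ℤ) + + 2 → j₁ ≡ j + 1ℤ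
    narrow-right kk≤ = ZP.≤-antisym (subst₂ _≤_ (cancel kk j₁) (shift j₁ j kk)
                                      (ZP.+-monoˡ-≤ (j₁ - kk) (subst (λ x → kk ≤ x + + 2) k-right-inner kk≤))) (<⇒suc≤ j<j₁)
      where
      cancel : ∀ kk j → kk + (j - kk) ≡ j
      cancel = solve-∀
      shift : ∀ a j kk → j + kk - a - 1ℤ + + 2 + (a - kk) ≡ j + 1ℤ
      shift = solve-∀

    record Narrow : Set where
      field
        j≡j₀+1   : j ≡ j₀ + 1ℤ
        j₁≡      : j₁ ≡ j₀ + 1ℤ + 1ℤ
        width    : n ≡ 2
        apex     : k one (j₀ + 1ℤ) + + 2 ≡ kk
        localMin : LocalMin k one (j₀ + 1ℤ)

    narrow : ∀ {m} → LowerBound k j₀ j₁ m → kk ≤ m + + 2 → Narrow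
    narrow {m} bound kk≤m+2 = record
      { j≡j₀+1 = j≡j₀+1 ; j₁≡ = j₁≡ ; width = width ; apex = apex-left j≡j₀+1 ; localMin = localMin }
      where
      j₀+1<j₁ : j₀ + 1ℤ < j₁
      j₀+1<j₁ = ZP.≤-<-trans j₀+1≤j j<j₁
      kk≤inner : ∀ {α s} → j₀ + 1ℤ ≤ s → s < j₁ → kk ≤ k α s + + 2
      kk≤inner {α} {s} j₀+1≤s s<j₁ = ZP.≤-trans kk≤m+2 (ZP.+-monoˡ-≤ (+ 2) (bound α s j₀+1≤s s<j₁))
      j≡j₀+1 : j ≡ j₀ + 1ℤ
      j≡j₀+1 = narrow-left (kk≤inner ZP.≤-refl j₀+1<j₁)
      j₁≡ : j₁ ≡ j₀ + 1ℤ + 1ℤ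
      j₁≡ = trans (narrow-right (kk≤inner (ZP.≤-trans j₀+1≤j j≤j₁-1) (pred-< j₁))) (cong (_+ 1ℤ) j≡j₀+1)
      width : n ≡ 2
      width = +-injectiveʳ j₀ (trans (sym length) (trans j₁≡ (sym (+1+1 j₀))))
      apex≤m : k one (j₀ + 1ℤ) ≤ m
      apex≤m = subst₂ _≤_ (trans (cong (_- + 2) (sym (apex-left j≡j₀+1))) (drop2 _)) (drop2 m)
                          (ZP.+-monoˡ-≤ (Z.- + 2) kk≤m+2)
        where
        drop2 : ∀ x → x + + 2 - + 2 ≡ x
        drop2 = solve-∀
      localMin : LocalMin k one (j₀ + 1ℤ)
      localMin = interior-min-local one (j₀ + 1ℤ) ZP.≤-refl j₀+1<j₁
                   (λ α s j₀+1≤s s<j₁ → ZP.≤-trans apex≤m (bound α s j₀+1≤s s<j₁))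

  window-transport : ∀ {k k′ j₀ j₁ n} → Window k j₀ j₁ n → Admissible k′ →
    k′ one j₀ ≡ k one j₀ → k′ one (j₀ + 1ℤ) ≡ k one (j₀ + 1ℤ) →
    k′ one (j₁ - 1ℤ) ≡ k one (j₁ - 1ℤ) → k′ one j₁ ≡ k one j₁ → Window k′ j₀ j₁ n
  window-transport {j₀ = j₀} {j₁} w adm′ e₀ e₀₊ e₁₋ e₁ = record
    { admissible     = adm′
    ; length         = length
    ; left-end       = trans (cong (j₀ -_) e₀) left-end
    ; right-end      = trans (cong (λ x → j₁ + x) e₁) right-end
    ; left-descends  = trans e₀₊ (trans left-descends (cong (_- 1ℤ) (sym e₀)))
    ; right-descends = trans e₁₋ (trans right-descends (cong (_- 1ℤ) (sym e₁)))
    ; j₀<j = j₀<j ; j<j₁ = j<j₁ ; A≤j₀ = A≤j₀ ; j₁≤A+W = j₁≤A+W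
    }
    where open Window w

  raise-window-two : ∀ {k j₀ j₁ n t} → Window k j₀ j₁ n → LocalMin k two t → Window (raise k two t) j₀ j₁ n
  raise-window-two {k} {j₀} {j₁} {t = t} w lm =
    window-transport w (raise-admissible (Window.admissible w) lm)
      (unchanged j₀) (unchanged (j₀ + 1ℤ)) (unchanged (j₁ - 1ℤ)) (unchanged j₁)
    where
    unchanged : ∀ s → raise k two t one s ≡ k one s
    unchanged s = raise-offRow k two t one s λ ()

  raise-window-interior : ∀ {k j₀ j₁ n t} → Window k j₀ j₁ n → LocalMin k one t →
    j₀ + 1ℤ ≤ t → t < j₁ → t ≢ j₀ + 1ℤ → t ≢ j₁ - 1ℤ → Window (raise k one t) j₀ j₁ n
  raise-window-interior {k} {j₀} {j₁} {t = t} w lm j₀+1≤t t<j₁ t≢j₀+1 t≢j₁-1 =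
    window-transport w (raise-admissible (Window.admissible w) lm)
      (unchanged j₀ λ j₀≡t → <-irrefl (ZP.<-≤-trans (<-suc j₀) (subst (j₀ + 1ℤ ≤_) (sym j₀≡t) j₀+1≤t)))
      (unchanged (j₀ + 1ℤ) λ e → t≢j₀+1 (sym e))
      (unchanged (j₁ - 1ℤ) λ e → t≢j₁-1 (sym e))
      (unchanged j₁ λ j₁≡t → <-irrefl (subst (t <_) j₁≡t t<j₁))
    where
    unchanged : ∀ s → s ≢ t → raise k one t one s ≡ k one s
    unchanged s s≢t = raise-off k one t one s s≢t

  raise-window-left : ∀ {k j₀ j₁ n t} → Window k j₀ j₁ (N.suc n) → LocalMin k one t →
    t ≡ j₀ + 1ℤ → k one t + + 2 < kk → Window (raise k one t) t j₁ n
  raise-window-left {k} {j₀} {j₁} {n} {t} w lm refl below = record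
    { admissible     = raise-admissible admissible lm
    ; length         = trans length (sym (+-suc-+ j₀ n))
    ; left-end       = begin
        t - raise k one t one t          ≡⟨ cong (t -_) (trans (raise-at k one t) (cong (_+ + 2) left-descends)) ⟩
        j₀ + 1ℤ - (k one j₀ - 1ℤ + + 2)  ≡⟨ shift j₀ (k one j₀) ⟩
        j₀ - k one j₀                    ≡⟨ left-end ⟩
        j - kk                           ∎
    ; right-end      = trans (cong (λ x → j₁ + x) (unchanged j₁ j₁≢t)) right-end
    ; left-descends  = begin
        raise k one t one (t + 1ℤ)  ≡⟨ unchanged (t + 1ℤ) (suc≢ t) ⟩
        k one (t + 1ℤ)              ≡⟨ LocalMin.right lm ⟩
        k one t + 1ℤ                ≡⟨ +2-1 (k one t) ⟩
        k one t + + 2 - 1ℤ           ≡⟨ cong (_- 1ℤ) (sym (raise-at k one t)) ⟩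
        raise k one t one t - 1ℤ    ∎
    ; right-descends = trans (unchanged (j₁ - 1ℤ) j₁-1≢t)
                         (trans right-descends (cong (_- 1ℤ) (sym (unchanged j₁ j₁≢t))))
    ; j₀<j = t<j ; j<j₁ = j<j₁
    ; A≤j₀ = ZP.≤-trans A≤j₀ (ZP.<⇒≤ (<-suc j₀))
    ; j₁≤A+W = j₁≤A+W
    }
    where
    open Window w
    open WindowFacts w
    open ≡-Reasoning
    shift : ∀ a x → a + 1ℤ - (x - 1ℤ + + 2) ≡ a - x
    shift = solve-∀
    unchanged : ∀ s → s ≢ t → raise k one t one s ≡ k one s
    unchanged s s≢t = raise-off k one t one s s≢t
    t<j : t < j
    t<j = ZP.≤∧≢⇒< j₀+1≤j λ t≡j → ZP.<⇒≢ below (apex-left (sym t≡j))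
    j₁≢t : j₁ ≢ t
    j₁≢t j₁≡t = <-irrefl (ZP.<-trans t<j (subst (j <_) j₁≡t j<j₁))
    j₁-1≢t : j₁ - 1ℤ ≢ t
    j₁-1≢t j₁-1≡t = <-irrefl (ZP.<-≤-trans t<j (subst (j ≤_) j₁-1≡t j≤j₁-1))

  raise-window-right : ∀ {k j₀ j₁ n t} → Window k j₀ j₁ (N.suc n) → LocalMin k one t →
    t ≡ j₁ - 1ℤ → k one t + + 2 < kk → Window (raise k one t) j₀ t n
  raise-window-right {k} {j₀} {j₁} {n} {t} w lm refl below = record
    { admissible     = raise-admissible admissible lm
    ; length         = trans (cong (_- 1ℤ) length) (shorten j₀ (+ n))
    ; left-end       = trans (cong (j₀ -_) (unchanged j₀ j₀≢t)) left-end
    ; right-end      = begin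
        t + raise k one t one t            ≡⟨ cong (λ x → t + x) (trans (raise-at k one t) (cong (_+ + 2) right-descends)) ⟩
        j₁ - 1ℤ + (k one j₁ - 1ℤ + + 2)    ≡⟨ shift j₁ (k one j₁) ⟩
        j₁ + k one j₁                      ≡⟨ right-end ⟩
        j + kk                             ∎
    ; left-descends  = trans (unchanged (j₀ + 1ℤ) j₀+1≢t)
                         (trans left-descends (cong (_- 1ℤ) (sym (unchanged j₀ j₀≢t))))
    ; right-descends = begin
        raise k one t one (t - 1ℤ)  ≡⟨ unchanged (t - 1ℤ) (pred≢ t) ⟩
        k one (t - 1ℤ)              ≡⟨ LocalMin.left lm ⟩
        k one t + 1ℤ                ≡⟨ +2-1 (k one t) ⟩
        k one t + + 2 - 1ℤ           ≡⟨ cong (_- 1ℤ) (sym (raise-at k one t)) ⟩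
        raise k one t one t - 1ℤ    ∎
    ; j₀<j = j₀<j ; j<j₁ = j<t
    ; A≤j₀ = A≤j₀
    ; j₁≤A+W = ZP.≤-trans (ZP.<⇒≤ (pred-< j₁)) j₁≤A+W
    }
    where
    open Window w
    open WindowFacts w
    open ≡-Reasoning
    shorten : ∀ a n → a + (1ℤ + n) - 1ℤ ≡ a + n
    shorten = solve-∀
    shift : ∀ a x → a - 1ℤ + (x - 1ℤ + + 2) ≡ a + x
    shift = solve-∀
    unchanged : ∀ s → s ≢ t → raise k one t one s ≡ k one s
    unchanged s s≢t = raise-off k one t one s s≢t
    j<t : j < t
    j<t = ZP.≤∧≢⇒< j≤j₁-1 λ j≡t → ZP.<⇒≢ below (apex-right (trans (sym (suc-pred j₁)) (cong (_+ 1ℤ) (sym j≡t))))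
    j₀≢t : j₀ ≢ t
    j₀≢t j₀≡t = <-irrefl (ZP.<-trans j₀<j (subst (j <_) (sym j₀≡t) j<t))
    j₀+1≢t : j₀ + 1ℤ ≢ t
    j₀+1≢t j₀+1≡t = <-irrefl (ZP.≤-<-trans (subst (_≤ j) j₀+1≡t j₀+1≤j) j<t)

module _ {k : Boundary} (adm : Admissible k) where

  up-flat : ∀ s → k one (s + 1ℤ) ≡ k one s + 1ℤ → s + 1ℤ - k one (s + 1ℤ) ≡ s - k one s
  up-flat s climb = trans (cong (s + 1ℤ -_) climb) (flat s (k one s))
    where
    flat : ∀ a x → a + 1ℤ - (x + 1ℤ) ≡ a - x
    flat = solve-∀

  down-flat : ∀ s → k one (s - 1ℤ) ≡ k one s + 1ℤ → s - 1ℤ + k one (s - 1ℤ) ≡ s + k one s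
  down-flat s climb = trans (cong (λ x → s - 1ℤ + x) climb) (flat s (k one s))
    where
    flat : ∀ a x → a - 1ℤ + (x + 1ℤ) ≡ a + x
    flat = solve-∀

  left-cone-mono : ∀ {a b} → a ≤ b → a - k one a ≤ b - k one b
  left-cone-mono = step-mono (λ s → s - k one s) λ s →
    subst (_≤ s + 1ℤ - k one (s + 1ℤ)) (shift s (k one s)) (ZP.+-monoʳ-≤ (s + 1ℤ) (ZP.neg-mono-≤ (step-≤ (right-step adm one s))))
    where
    shift : ∀ a x → a + 1ℤ + Z.- (x + 1ℤ) ≡ a - x
    shift = solve-∀

  right-cone-mono : ∀ {a b} → a ≤ b → a + k one a ≤ b + k one b
  right-cone-mono = step-mono (λ s → s + k one s) λ s →
    subst (_≤ s + 1ℤ + k one (s + 1ℤ)) (shift s (k one s)) (ZP.+-monoʳ-≤ (s + 1ℤ) (step-≥ (right-step adm one s)))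
    where
    shift : ∀ a x → a + 1ℤ + (x - 1ℤ) ≡ a + x
    shift = solve-∀

-- the hypotheses of the theorem say that [j₀, j₁] is a window: by
-- maximality of j₀ and minimality of j₁ row one descends into it, and by
-- monotonicity of the cone coordinates j lies strictly inside it
initial-window : ∀ {k} → Admissible k → ∀ {j kk} → k one j < kk →
  ∀ {j₀} → j₀ - k one j₀ ≡ j - kk → (∀ j′ → j′ - k one j′ ≡ j - kk → j′ ≤ j₀) →
  ∀ {j₁} → j₁ + k one j₁ ≡ j + kk → (∀ j′ → j′ + k one j′ ≡ j + kk → j₁ ≤ j′) →
  Cone.Window j kk j₀ (∣ j₁ - j₀ ∣) k j₀ j₁ (∣ j₁ - j₀ ∣)
initial-window {k} adm {j} {kk} k₁j<kk {j₀} left-end j₀-max {j₁} right-end j₁-min = record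
  { admissible     = adm
  ; length         = length
  ; left-end       = left-end
  ; right-end      = right-end
  ; left-descends  = step-notUp (right-step adm one j₀) λ climb →
      <-irrefl (ZP.<-≤-trans (<-suc j₀) (j₀-max (j₀ + 1ℤ) (trans (up-flat adm j₀ climb) left-end)))
  ; right-descends = step-notUp (left-step adm one j₁) λ climb →
      <-irrefl (ZP.≤-<-trans (j₁-min (j₁ - 1ℤ) (trans (down-flat adm j₁ climb) right-end)) (pred-< j₁))
  ; j₀<j   = j₀<j
  ; j<j₁   = j<j₁
  ; A≤j₀   = ZP.≤-refl
  ; j₁≤A+W = ZP.≤-reflexive length
  }
  where
  j₀<j : j₀ < j
  j₀<j with j₀ ZP.<? j
  ... | yes j₀<j = j₀<j
  ... | no j₀≮j = ⊥-elim (ZP.≤⇒≯ (subst (j - k one j ≤_) left-end (left-cone-mono adm (ZP.≮⇒≥ j₀≮j)))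
                                  (ZP.+-monoʳ-< j (ZP.neg-mono-< k₁j<kk)))
  j<j₁ : j < j₁
  j<j₁ with j ZP.<? j₁
  ... | yes j<j₁ = j<j₁
  ... | no j≮j₁ = ⊥-elim (ZP.≤⇒≯ (subst (_≤ j + k one j) right-end (right-cone-mono adm (ZP.≮⇒≥ j≮j₁)))
                                 (ZP.+-monoʳ-< j k₁j<kk))
  length : j₁ ≡ j₀ + + ∣ j₁ - j₀ ∣
  length = ≤⇒≡+∣-∣ (ZP.<⇒≤ (ZP.<-trans j₀<j j<j₁))

module Matrices {c ℓ : Level} (F : Field c ℓ) where
  open Field F using (Carrier; _≈_; 0#; 1#; _⁻¹; _/_; setoid; inverseʳ; *-comm)
    renaming (_+_ to _⊕_; _*_ to _·_; refl to ≈-refl; sym to ≈-sym; trans to ≈-trans;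
              +-cong to ⊕-cong; *-cong to ·-cong;
              zeroˡ to 0·; zeroʳ to ·0; *-identityˡ to 1·; *-identityʳ to ·1;
              +-identityˡ to 0⊕; +-identityʳ to ⊕0)
  open import Algebra.Solver.Ring.NaturalCoefficients.Default (Field.commutativeSemiring F)

  infixl 7 _⊛_
  _⊛_ : Mat F → Mat F → Mat F
  A ⊛ B = _⊗_ F A B

  infix 4 _≈ᴹ_
  record _≈ᴹ_ (A B : Mat F) : Set ℓ where
    constructor entrywise
    field entry : ∀ i l → A i l ≈ B i l
  open _≈ᴹ_ public

  ≈ᴹ-refl : ∀ {A} → A ≈ᴹ A
  ≈ᴹ-refl = entrywise λ _ _ → ≈-refl

  ≈ᴹ-sym : ∀ {A B} → A ≈ᴹ B → B ≈ᴹ A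
  ≈ᴹ-sym A≈B = entrywise λ i l → ≈-sym (entry A≈B i l)

  ≈ᴹ-trans : ∀ {A B C} → A ≈ᴹ B → B ≈ᴹ C → A ≈ᴹ C
  ≈ᴹ-trans A≈B B≈C = entrywise λ i l → ≈-trans (entry A≈B i l) (entry B≈C i l)

  ≡⇒≈ᴹ : ∀ {A B} → A ≡ B → A ≈ᴹ B
  ≡⇒≈ᴹ refl = ≈ᴹ-refl

  ⊛-cong : ∀ {A A′ B B′} → A ≈ᴹ A′ → B ≈ᴹ B′ → A ⊛ B ≈ᴹ A′ ⊛ B′
  ⊛-cong A≈ B≈ = entrywise λ i l →
    ⊕-cong (⊕-cong (·-cong (entry A≈ i zero) (entry B≈ zero l))
                   (·-cong (entry A≈ i (suc zero)) (entry B≈ (suc zero) l)))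
           (·-cong (entry A≈ i (suc (suc zero))) (entry B≈ (suc (suc zero)) l))

  ⊛-assoc : ∀ A B C → (A ⊛ B) ⊛ C ≈ᴹ A ⊛ (B ⊛ C)
  ⊛-assoc A B C = entrywise λ i l → assoc₃
    (A i zero) (A i (suc zero)) (A i (suc (suc zero)))
    (B zero zero) (B zero (suc zero)) (B zero (suc (suc zero)))
    (B (suc zero) zero) (B (suc zero) (suc zero)) (B (suc zero) (suc (suc zero)))
    (B (suc (suc zero)) zero) (B (suc (suc zero)) (suc zero)) (B (suc (suc zero)) (suc (suc zero)))
    (C zero l) (C (suc zero) l) (C (suc (suc zero)) l)
    where
    assoc₃ : ∀ a₀ a₁ a₂ b₀₀ b₀₁ b₀₂ b₁₀ b₁₁ b₁₂ b₂₀ b₂₁ b₂₂ c₀ c₁ c₂ →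
      (a₀ · b₀₀ ⊕ a₁ · b₁₀ ⊕ a₂ · b₂₀) · c₀ ⊕ (a₀ · b₀₁ ⊕ a₁ · b₁₁ ⊕ a₂ · b₂₁) · c₁
        ⊕ (a₀ · b₀₂ ⊕ a₁ · b₁₂ ⊕ a₂ · b₂₂) · c₂
      ≈ a₀ · (b₀₀ · c₀ ⊕ b₀₁ · c₁ ⊕ b₀₂ · c₂) ⊕ a₁ · (b₁₀ · c₀ ⊕ b₁₁ · c₁ ⊕ b₁₂ · c₂)
        ⊕ a₂ · (b₂₀ · c₀ ⊕ b₂₁ · c₁ ⊕ b₂₂ · c₂)
    assoc₃ = solve 15 (λ a₀ a₁ a₂ b₀₀ b₀₁ b₀₂ b₁₀ b₁₁ b₁₂ b₂₀ b₂₁ b₂₂ c₀ c₁ c₂ →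
      (a₀ :* b₀₀ :+ a₁ :* b₁₀ :+ a₂ :* b₂₀) :* c₀ :+ (a₀ :* b₀₁ :+ a₁ :* b₁₁ :+ a₂ :* b₂₁) :* c₁
        :+ (a₀ :* b₀₂ :+ a₁ :* b₁₂ :+ a₂ :* b₂₂) :* c₂
      := a₀ :* (b₀₀ :* c₀ :+ b₀₁ :* c₁ :+ b₀₂ :* c₂) :+ a₁ :* (b₁₀ :* c₀ :+ b₁₁ :* c₁ :+ b₁₂ :* c₂)
        :+ a₂ :* (b₂₀ :* c₀ :+ b₂₁ :* c₁ :+ b₂₂ :* c₂)) ≈-refl

  ⊛-middle : ∀ {X P Q P′ Q′ Y} → P ⊛ Q ≈ᴹ P′ ⊛ Q′ → (X ⊛ P) ⊛ (Q ⊛ Y) ≈ᴹ (X ⊛ P′) ⊛ (Q′ ⊛ Y)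
  ⊛-middle {X} {P} {Q} {P′} {Q′} {Y} PQ≈ =
    ≈ᴹ-trans (⊛-assoc X P (Q ⊛ Y))
    (≈ᴹ-trans (⊛-cong (≈ᴹ-refl {X}) (≈ᴹ-sym (⊛-assoc P Q Y)))
    (≈ᴹ-trans (⊛-cong (≈ᴹ-refl {X}) (⊛-cong PQ≈ (≈ᴹ-refl {Y})))
    (≈ᴹ-trans (⊛-cong (≈ᴹ-refl {X}) (⊛-assoc P′ Q′ Y))
              (≈ᴹ-sym (⊛-assoc X P′ (Q′ ⊛ Y))))))

  only₁ : ∀ {a b d x} → a ≈ x → b ≈ 0# → d ≈ 0# → a ⊕ b ⊕ d ≈ x
  only₁ a≈ b≈ d≈ = ≈-trans (⊕-cong (⊕-cong a≈ b≈) d≈) (≈-trans (⊕0 _) (⊕0 _))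
  only₂ : ∀ {a b d x} → a ≈ 0# → b ≈ x → d ≈ 0# → a ⊕ b ⊕ d ≈ x
  only₂ a≈ b≈ d≈ = ≈-trans (⊕-cong (⊕-cong a≈ b≈) d≈) (≈-trans (⊕0 _) (0⊕ _))
  only₃ : ∀ {a b d x} → a ≈ 0# → b ≈ 0# → d ≈ x → a ⊕ b ⊕ d ≈ x
  only₃ a≈ b≈ d≈ = ≈-trans (⊕-cong (⊕-cong a≈ b≈) d≈) (≈-trans (⊕-cong (0⊕ 0#) ≈-refl) (0⊕ _))
  drop₃ : ∀ {a b d} → d ≈ 0# → a ⊕ b ⊕ d ≈ a ⊕ b
  drop₃ d≈ = ≈-trans (⊕-cong ≈-refl d≈) (⊕0 _)
  drop₁ : ∀ {a b d} → a ≈ 0# → a ⊕ b ⊕ d ≈ b ⊕ d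
  drop₁ a≈ = ⊕-cong (≈-trans (⊕-cong a≈ ≈-refl) (0⊕ _)) ≈-refl

  meet : ∀ {a b x} → a ≈ x → b ≈ x → a ≈ b
  meet a≈x b≈x = ≈-trans a≈x (≈-sym b≈x)

  ⊛-identityˡ : ∀ A → idMat F ⊛ A ≈ᴹ A
  ⊛-identityˡ A = entrywise λ
    { zero             l → only₁ (1· _) (0· _) (0· _)
    ; (suc zero)       l → only₂ (0· _) (1· _) (0· _)
    ; (suc (suc zero)) l → only₃ (0· _) (0· _) (1· _) }

  ⊛-identityʳ : ∀ A → A ⊛ idMat F ≈ᴹ A
  ⊛-identityʳ A = entrywise λ
    { i zero             → only₁ (·1 _) (·0 _) (·0 _)
    ; i (suc zero)       → only₂ (·0 _) (·1 _) (·0 _)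
    ; i (suc (suc zero)) → only₃ (·0 _) (·0 _) (·1 _) }

  UnitFirstRow : Mat F → Set ℓ
  UnitFirstRow A = (A zero zero ≈ 1#) × (A zero (suc zero) ≈ 0#) × (A zero (suc (suc zero)) ≈ 0#)

  unitFirstRow-⊛ : ∀ {A} B → UnitFirstRow A → ∀ l → (A ⊛ B) zero l ≈ B zero l
  unitFirstRow-⊛ B (a₀ , a₁ , a₂) l =
    only₁ (≈-trans (·-cong a₀ ≈-refl) (1· _)) (≈-trans (·-cong a₁ ≈-refl) (0· _)) (≈-trans (·-cong a₂ ≈-refl) (0· _))

  unitFirstRow-resp : ∀ {A B} → A ≈ᴹ B → UnitFirstRow B → UnitFirstRow A
  unitFirstRow-resp A≈B (b₀ , b₁ , b₂) =
    ≈-trans (entry A≈B zero zero) b₀ , ≈-trans (entry A≈B zero (suc zero)) b₁ , ≈-trans (entry A≈B zero (suc (suc zero))) b₂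

  unitFirstRow-⊛-closed : ∀ {A B} → UnitFirstRow A → UnitFirstRow B → UnitFirstRow (A ⊛ B)
  unitFirstRow-⊛-closed {A} {B} rowA (b₀ , b₁ , b₂) =
    ≈-trans (unitFirstRow-⊛ {A} B rowA zero) b₀ ,
    ≈-trans (unitFirstRow-⊛ {A} B rowA (suc zero)) b₁ ,
    ≈-trans (unitFirstRow-⊛ {A} B rowA (suc (suc zero))) b₂

  FirstColumn : Carrier → Mat F → Set ℓ
  FirstColumn v A = (A zero zero ≈ v) × (A (suc zero) zero ≈ 0#) × (A (suc (suc zero)) zero ≈ 0#)

  firstColumn-⊛ : ∀ {v A} B → FirstColumn v A → (B ⊛ A) zero zero ≈ B zero zero · v
  firstColumn-⊛ B (a₀ , a₁ , a₂) =
    only₁ (·-cong ≈-refl a₀) (≈-trans (·-cong ≈-refl a₁) (·0 _)) (≈-trans (·-cong ≈-refl a₂) (·0 _))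

  firstColumn-resp : ∀ {v A B} → A ≈ᴹ B → FirstColumn v B → FirstColumn v A
  firstColumn-resp A≈B (b₀ , b₁ , b₂) =
    ≈-trans (entry A≈B zero zero) b₀ , ≈-trans (entry A≈B (suc zero) zero) b₁ , ≈-trans (entry A≈B (suc (suc zero)) zero) b₂

  firstColumn-⊛-closed : ∀ {v A Y} → FirstColumn v A → FirstColumn 1# Y → FirstColumn v (A ⊛ Y)
  firstColumn-⊛-closed {A = A} {Y} (a₀ , a₁ , a₂) (y₀ , y₁ , y₂) = column zero a₀ , column (suc zero) a₁ , column (suc (suc zero)) a₂
    where
    column : ∀ i {w} → A i zero ≈ w → (A ⊛ Y) i zero ≈ w
    column i aᵢ = only₁ (≈-trans (·-cong aᵢ y₀) (·1 _)) (≈-trans (·-cong ≈-refl y₁) (·0 _)) (≈-trans (·-cong ≈-refl y₂) (·0 _))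

  block-⊛ : ∀ α p q r s p′ q′ r′ s′ →
    block F α p q r s ⊛ block F α p′ q′ r′ s′ ≈ᴹ
      block F α (p · p′ ⊕ q · r′) (p · q′ ⊕ q · s′) (r · p′ ⊕ s · r′) (r · q′ ⊕ s · s′)
  block-⊛ one p q r s p′ q′ r′ s′ = entrywise λ
    { zero zero                         → drop₃ (0· _)
    ; zero (suc zero)                   → drop₃ (0· _)
    ; zero (suc (suc zero))             → only₃ (·0 _) (·0 _) (0· _)
    ; (suc zero) zero                   → drop₃ (0· _)
    ; (suc zero) (suc zero)             → drop₃ (0· _)
    ; (suc zero) (suc (suc zero))       → only₃ (·0 _) (·0 _) (0· _)
    ; (suc (suc zero)) zero             → only₃ (0· _) (0· _) (1· _)
    ; (suc (suc zero)) (suc zero)       → only₃ (0· _) (0· _) (1· _)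
    ; (suc (suc zero)) (suc (suc zero)) → only₃ (0· _) (0· _) (1· _) }
  block-⊛ two p q r s p′ q′ r′ s′ = entrywise λ
    { zero zero                         → only₁ (1· _) (0· _) (0· _)
    ; zero (suc zero)                   → only₁ (1· _) (0· _) (0· _)
    ; zero (suc (suc zero))             → only₁ (1· _) (0· _) (0· _)
    ; (suc zero) zero                   → only₁ (0· _) (·0 _) (·0 _)
    ; (suc zero) (suc zero)             → drop₁ (0· _)
    ; (suc zero) (suc (suc zero))       → drop₁ (0· _)
    ; (suc (suc zero)) zero             → only₁ (0· _) (·0 _) (·0 _)
    ; (suc (suc zero)) (suc zero)       → drop₁ (0· _)
    ; (suc (suc zero)) (suc (suc zero)) → drop₁ (0· _) }

  block-cong : ∀ α {p q r s p′ q′ r′ s′} → p ≈ p′ → q ≈ q′ → r ≈ r′ → s ≈ s′ →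
    block F α p q r s ≈ᴹ block F α p′ q′ r′ s′
  block-cong one p≈ q≈ r≈ s≈ = entrywise λ
    { zero zero → p≈ ; zero (suc zero) → q≈ ; (suc zero) zero → r≈ ; (suc zero) (suc zero) → s≈
    ; zero (suc (suc zero)) → ≈-refl ; (suc zero) (suc (suc zero)) → ≈-refl
    ; (suc (suc zero)) zero → ≈-refl ; (suc (suc zero)) (suc zero) → ≈-refl ; (suc (suc zero)) (suc (suc zero)) → ≈-refl }
  block-cong two p≈ q≈ r≈ s≈ = entrywise λ
    { (suc zero) (suc zero) → p≈ ; (suc zero) (suc (suc zero)) → q≈
    ; (suc (suc zero)) (suc zero) → r≈ ; (suc (suc zero)) (suc (suc zero)) → s≈
    ; zero zero → ≈-refl ; zero (suc zero) → ≈-refl ; zero (suc (suc zero)) → ≈-refl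
    ; (suc zero) zero → ≈-refl ; (suc (suc zero)) zero → ≈-refl }

  module ExchangeEntries (x a c c′ b u : Carrier) (b≉0 : ¬ (b ≈ 0#)) (c≉0 : ¬ (c ≈ 0#)) (c′≉0 : ¬ (c′ ≈ 0#))
                         (relation : c · c′ ≈ a · b ⊕ x · u) where
    open SetoidReasoning setoid
    c⁻ b⁻ c′⁻ : Carrier
    c⁻ = c ⁻¹
    b⁻ = b ⁻¹
    c′⁻ = c′ ⁻¹

    top-left : (a · c⁻) · 1# ⊕ (x · c⁻) · (u · b⁻) ≈ 1# · (c′ · b⁻) ⊕ 0# · 0#
    top-left = begin
      (a · c⁻) · 1# ⊕ (x · c⁻) · (u · b⁻)          ≈⟨ ⊕-cong (·-cong ≈-refl (≈-sym (inverseʳ b b≉0))) ≈-refl ⟩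
      (a · c⁻) · (b · b⁻) ⊕ (x · c⁻) · (u · b⁻)
        ≈⟨ solve 6 (λ a c⁻ b b⁻ x u → (a :* c⁻) :* (b :* b⁻) :+ (x :* c⁻) :* (u :* b⁻)
                     := (c⁻ :* b⁻) :* (a :* b :+ x :* u)) ≈-refl a c⁻ b b⁻ x u ⟩
      (c⁻ · b⁻) · (a · b ⊕ x · u)                  ≈⟨ ·-cong ≈-refl (≈-sym relation) ⟩
      (c⁻ · b⁻) · (c · c′)
        ≈⟨ solve 4 (λ c⁻ b⁻ c c′ → (c⁻ :* b⁻) :* (c :* c′) := (c :* c⁻) :* (c′ :* b⁻) :+ con 0 :* con 0)
             ≈-refl c⁻ b⁻ c c′ ⟩
      (c · c⁻) · (c′ · b⁻) ⊕ 0# · 0#               ≈⟨ ⊕-cong (·-cong (inverseʳ c c≉0) ≈-refl) ≈-refl ⟩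
      1# · (c′ · b⁻) ⊕ 0# · 0#                     ∎
    top-right : (a · c⁻) · 0# ⊕ (x · c⁻) · (c · b⁻) ≈ 1# · (x · b⁻) ⊕ 0# · 1#
    top-right = begin
      (a · c⁻) · 0# ⊕ (x · c⁻) · (c · b⁻)
        ≈⟨ solve 5 (λ a c⁻ x c b⁻ → (a :* c⁻) :* con 0 :+ (x :* c⁻) :* (c :* b⁻)
                     := (c :* c⁻) :* (x :* b⁻) :+ con 0 :* con 1) ≈-refl a c⁻ x c b⁻ ⟩
      (c · c⁻) · (x · b⁻) ⊕ 0# · 1#                ≈⟨ ⊕-cong (·-cong (inverseʳ c c≉0) ≈-refl) ≈-refl ⟩
      1# · (x · b⁻) ⊕ 0# · 1#                      ∎
    bottom-left : 0# · 1# ⊕ 1# · (u · b⁻) ≈ (u · c′⁻) · (c′ · b⁻) ⊕ (a · c′⁻) · 0#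
    bottom-left = ≈-sym (begin
      (u · c′⁻) · (c′ · b⁻) ⊕ (a · c′⁻) · 0#
        ≈⟨ solve 5 (λ u c′⁻ c′ b⁻ a → (u :* c′⁻) :* (c′ :* b⁻) :+ (a :* c′⁻) :* con 0
                     := con 0 :* con 1 :+ (c′ :* c′⁻) :* (u :* b⁻)) ≈-refl u c′⁻ c′ b⁻ a ⟩
      0# · 1# ⊕ (c′ · c′⁻) · (u · b⁻)              ≈⟨ ⊕-cong ≈-refl (·-cong (inverseʳ c′ c′≉0) ≈-refl) ⟩
      0# · 1# ⊕ 1# · (u · b⁻)                      ∎)
    bottom-right : 0# · 0# ⊕ 1# · (c · b⁻) ≈ (u · c′⁻) · (x · b⁻) ⊕ (a · c′⁻) · 1#
    bottom-right = ≈-sym (begin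
      (u · c′⁻) · (x · b⁻) ⊕ (a · c′⁻) · 1#         ≈⟨ ⊕-cong ≈-refl (·-cong ≈-refl (≈-sym (inverseʳ b b≉0))) ⟩
      (u · c′⁻) · (x · b⁻) ⊕ (a · c′⁻) · (b · b⁻)
        ≈⟨ solve 6 (λ u c′⁻ x b⁻ a b → (u :* c′⁻) :* (x :* b⁻) :+ (a :* c′⁻) :* (b :* b⁻)
                     := (c′⁻ :* b⁻) :* (a :* b :+ x :* u)) ≈-refl u c′⁻ x b⁻ a b ⟩
      (c′⁻ · b⁻) · (a · b ⊕ x · u)                 ≈⟨ ·-cong ≈-refl (≈-sym relation) ⟩
      (c′⁻ · b⁻) · (c · c′)
        ≈⟨ solve 4 (λ c′⁻ b⁻ c c′ → (c′⁻ :* b⁻) :* (c :* c′) := con 0 :* con 0 :+ (c′ :* c′⁻) :* (c :* b⁻))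
             ≈-refl c′⁻ b⁻ c c′ ⟩
      0# · 0# ⊕ (c′ · c′⁻) · (c · b⁻)              ≈⟨ ⊕-cong ≈-refl (·-cong (inverseʳ c′ c′≉0) ≈-refl) ⟩
      0# · 0# ⊕ 1# · (c · b⁻)                      ∎)

  exchange : ∀ α x a c c′ b u → ¬ (b ≈ 0#) → ¬ (c ≈ 0#) → ¬ (c′ ≈ 0#) →
    c · c′ ≈ a · b ⊕ x · u →
    V F α x a c ⊛ H F α c b u ≈ᴹ H F α a c′ u ⊛ V F α x c′ b
  exchange α x a c c′ b u b≉0 c≉0 c′≉0 relation =
    ≈ᴹ-trans (block-⊛ α _ _ _ _ _ _ _ _)
      (≈ᴹ-trans (block-cong α top-left top-right bottom-left bottom-right) (≈ᴹ-sym (block-⊛ α _ _ _ _ _ _ _ _)))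
    where open ExchangeEntries x a c c′ b u b≉0 c≉0 c′≉0 relation

  cancel-middle : ∀ x y z → ¬ (y ≈ 0#) → (x · y ⁻¹) · (y · z) ≈ x · z
  cancel-middle x y z y≉0 = ≈-trans
    (solve 4 (λ x y⁻ y z → (x :* y⁻) :* (y :* z) := (y :* y⁻) :* (x :* z)) ≈-refl x (y ⁻¹) y z)
    (≈-trans (·-cong (inverseʳ y y≉0) ≈-refl) (1· _))

  -- row two climbs while row one descends (k₂ = k₁ + 1 at t)
  slice-diagonals-up : ∀ a₁ b₁ a₂ b₂ → ¬ (b₁ ≈ 0#) → ¬ (b₂ ≈ 0#) →
    V F two a₁ a₂ b₂ ⊛ H F one a₁ b₁ b₂ ≈ᴹ H F one a₁ b₁ a₂ ⊛ V F two b₁ a₂ b₂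
  slice-diagonals-up a₁ b₁ a₂ b₂ b₁≉0 b₂≉0 = entrywise λ
    { zero zero                         → meet (only₁ (1· _) (0· _) (0· _)) (only₁ (1· _) (0· _) (0· _))
    ; zero (suc zero)                   → meet (only₁ (1· _) (0· _) (0· _)) (only₁ (1· _) (0· _) (0· _))
    ; zero (suc (suc zero))             → meet (only₁ (1· _) (0· _) (0· _)) (only₁ (1· _) (0· _) (0· _))
    ; (suc zero) zero                   → meet (only₂ (0· _) (cancel-middle a₂ b₂ (b₁ ⁻¹) b₂≉0) (·0 _))
                                               (only₁ (·1 _) (·0 _) (0· _))
    ; (suc zero) (suc zero)             → meet (only₂ (0· _) (*-comm _ _) (·0 _)) (only₂ (·0 _) ≈-refl (0· _))
    ; (suc zero) (suc (suc zero))       → meet (only₃ (0· _) (·0 _) (·1 _))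
                                               (only₂ (·0 _) (cancel-middle a₁ b₁ (b₂ ⁻¹) b₁≉0) (0· _))
    ; (suc (suc zero)) zero             → meet (only₃ (0· _) (0· _) (1· _)) (only₃ (0· _) (0· _) (1· _))
    ; (suc (suc zero)) (suc zero)       → meet (only₃ (0· _) (0· _) (1· _)) (only₃ (0· _) (0· _) (1· _))
    ; (suc (suc zero)) (suc (suc zero)) → meet (only₃ (0· _) (0· _) (1· _)) (only₃ (0· _) (0· _) (1· _)) }

  -- row one climbs while row two descends (k₂ = k₁ - 1 at t): the factors commute
  slice-diagonals-down : ∀ a b u x a′ b′ → H F two a b u ⊛ V F one x a′ b′ ≈ᴹ V F one x a′ b′ ⊛ H F two a b u
  slice-diagonals-down a b u x a′ b′ = entrywise λ
    { zero zero                         → meet (only₁ (1· _) (0· _) (0· _)) (only₁ (·1 _) (·0 _) (0· _))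
    ; zero (suc zero)                   → meet (only₁ (1· _) (0· _) (0· _)) (only₂ (·0 _) (·1 _) (0· _))
    ; zero (suc (suc zero))             → meet (only₁ (1· _) (0· _) (0· _)) (only₁ (·0 _) (·0 _) (0· _))
    ; (suc zero) zero                   → meet (only₁ (0· _) (1· _) (0· _)) (only₁ (0· _) (1· _) (0· _))
    ; (suc zero) (suc zero)             → meet (only₂ (0· _) (1· _) (0· _)) (only₂ (0· _) (1· _) (0· _))
    ; (suc zero) (suc (suc zero))       → meet (only₁ (0· _) (1· _) (0· _)) (only₁ (0· _) (1· _) (0· _))
    ; (suc (suc zero)) zero             → meet (only₁ (0· _) (·0 _) (·0 _)) (only₁ (0· _) (0· _) (1· _))
    ; (suc (suc zero)) (suc zero)       → meet (only₂ (0· _) (·1 _) (·0 _)) (only₃ (0· _) (0· _) (1· _))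
    ; (suc (suc zero)) (suc (suc zero)) → meet (only₃ (0· _) (·0 _) (·1 _)) (only₃ (0· _) (0· _) (1· _)) }

  prod : (ℤ → Mat F) → ℤ → N.ℕ → Mat F
  prod = prodFrom F

  prod-cong : ∀ S S′ a n → (∀ s → a ≤ s → S s ≈ᴹ S′ s) → prod S a n ≈ᴹ prod S′ a n
  prod-cong S S′ a N.zero    S≈S′ = ≈ᴹ-refl
  prod-cong S S′ a (N.suc n) S≈S′ =
    ⊛-cong (S≈S′ a ZP.≤-refl) (prod-cong S S′ (a + 1ℤ) n λ s a+1≤s → S≈S′ s (ZP.≤-trans (ZP.<⇒≤ (<-suc a)) a+1≤s))

  prod-local : ∀ S S′ u a n → (∀ s → s ≢ u → s ≢ u + 1ℤ → S s ≈ᴹ S′ s) →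
    S u ⊛ S (u + 1ℤ) ≈ᴹ S′ u ⊛ S′ (u + 1ℤ) → a ≤ u → u + 1ℤ < a + + n → prod S a n ≈ᴹ prod S′ a n
  prod-local S S′ u a N.zero elsewhere pair a≤u u+1< =
    ⊥-elim (ZP.≤⇒≯ a≤u (ZP.<-trans (<-suc u) (subst (u + 1ℤ <_) (ZP.+-identityʳ a) u+1<)))
  prod-local S S′ u a (N.suc n) elsewhere pair a≤u u+1< with a Z.≟ u
  prod-local S S′ u a (N.suc N.zero) elsewhere pair a≤u u+1< | yes refl =
    ⊥-elim (<-irrefl u+1<)
  prod-local S S′ u a (N.suc (N.suc n)) elsewhere pair a≤u u+1< | yes refl =
    ≈ᴹ-trans (≈ᴹ-sym (⊛-assoc (S u) (S (u + 1ℤ)) (prod S (u + 1ℤ + 1ℤ) n)))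
      (≈ᴹ-trans (⊛-cong pair (prod-cong S S′ (u + 1ℤ + 1ℤ) n beyond))
                (⊛-assoc (S′ u) (S′ (u + 1ℤ)) (prod S′ (u + 1ℤ + 1ℤ) n)))
    where
    beyond : ∀ s → u + 1ℤ + 1ℤ ≤ s → S s ≈ᴹ S′ s
    beyond s u+2≤s = elsewhere s
      (λ s≡u → <-irrefl (ZP.<-≤-trans (ZP.<-trans (<-suc u) (<-suc (u + 1ℤ))) (subst (u + 1ℤ + 1ℤ ≤_) s≡u u+2≤s)))
      (λ s≡u+1 → <-irrefl (ZP.<-≤-trans (<-suc (u + 1ℤ)) (subst (u + 1ℤ + 1ℤ ≤_) s≡u+1 u+2≤s)))
  ... | no a≢u =
    ⊛-cong (elsewhere a a≢u λ a≡u+1 → <-irrefl (ZP.≤-<-trans (subst (_≤ u) a≡u+1 a≤u) (<-suc u)))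
           (prod-local S S′ u (a + 1ℤ) n elsewhere pair (<⇒suc≤ (ZP.≤∧≢⇒< a≤u a≢u))
                       (subst (u + 1ℤ <_) (sym (+-suc-+ a n)) u+1<))

  prod-snoc : ∀ S a n → prod S a (N.suc n) ≈ᴹ prod S a n ⊛ S (a + + n)
  prod-snoc S a N.zero =
    ≈ᴹ-trans (⊛-identityʳ (S a)) (≈ᴹ-trans (≡⇒≈ᴹ (cong S (sym (ZP.+-identityʳ a)))) (≈ᴹ-sym (⊛-identityˡ _)))
  prod-snoc S a (N.suc n) =
    ≈ᴹ-trans (⊛-cong (≈ᴹ-refl {S a}) (prod-snoc S (a + 1ℤ) n))
      (≈ᴹ-trans (≈ᴹ-sym (⊛-assoc (S a) (prod S (a + 1ℤ) n) (S (a + 1ℤ + + n))))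
                (⊛-cong (≈ᴹ-refl {S a ⊛ prod S (a + 1ℤ) n}) (≡⇒≈ᴹ (cong S (+-suc-+ a n)))))

Diagonals : Boundary → (ℤ → Diag) → Set
Diagonals k d = ∀ s → DiagOK k s (d s)

diagOK-transport : ∀ {k k′ s} D → (∀ α → k′ α s ≡ k α s) → (∀ α → k′ α (s + 1ℤ) ≡ k α (s + 1ℤ)) →
                   DiagOK k s D → DiagOK k′ s D
diagOK-transport swne same₀ same₁ ok = trans (same₀ one) (trans ok (sym (same₁ two)))
diagOK-transport nwse same₀ same₁ ok = trans (same₁ one) (trans ok (sym (same₀ two)))

rechoose : (ℤ → Diag) → ℤ → Diag → Diag → ℤ → Diag
rechoose d t D₁ D₂ s with s Z.≟ t | s Z.≟ t - 1ℤ
... | yes _ | _     = D₂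
... | no _  | yes _ = D₁
... | no _  | no _  = d s

rechoose-ok : ∀ {k k′ t d D₁ D₂} → (∀ α s → s ≢ t → k′ α s ≡ k α s) → Diagonals k d →
              DiagOK k′ (t - 1ℤ) D₁ → DiagOK k′ t D₂ → Diagonals k′ (rechoose d t D₁ D₂)
rechoose-ok {k} {k′} {t} {d} {D₁} {D₂} same diagonals ok₁ ok₂ s with s Z.≟ t | s Z.≟ t - 1ℤ
... | yes refl | _    = ok₂
... | no _  | yes refl = ok₁
... | no s≢t | no s≢t-1 =
  diagOK-transport (d s) (λ α → same α s s≢t) (λ α → same α (s + 1ℤ) (≢pred⇒suc≢ s≢t-1)) (diagonals s)

module Slices {ℓᶜ ℓ : Level} (F : Field ℓᶜ ℓ) (T : Idx → ℤ → ℤ → Field.Carrier F) where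
  open Field F using (Carrier; _≈_; 0#; 1#; _/_; setoid; *-comm)
    renaming (_+_ to _⊕_; _*_ to _·_; refl to ≈-refl; sym to ≈-sym; trans to ≈-trans;
              +-cong to ⊕-cong; *-identityˡ to 1·; *-identityʳ to ·1)
  open Matrices F

  climbs : Boundary → Idx → ℤ → Bool
  climbs k α s = does (k α (s + 1ℤ) Z.≟ k α s + 1ℤ)

  climbs-true : ∀ k α s → k α (s + 1ℤ) ≡ k α s + 1ℤ → climbs k α s ≡ true
  climbs-true k α s climb = dec-true (k α (s + 1ℤ) Z.≟ k α s + 1ℤ) climb

  climbs-false : ∀ k α s → k α (s + 1ℤ) ≡ k α s - 1ℤ → climbs k α s ≡ false
  climbs-false k α s descend = dec-false (k α (s + 1ℤ) Z.≟ k α s + 1ℤ)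
    λ climb → up≢down (k α s) (trans (sym climb) descend)

  factor₁ : Bool → (a₁ b₁ u : Carrier) → Mat F
  factor₁ true  a₁ b₁ u = H F one a₁ b₁ u
  factor₁ false a₁ b₁ u = V F one 1# a₁ b₁

  factor₂ : Bool → (x a₂ b₂ : Carrier) → Mat F
  factor₂ true  x a₂ b₂ = H F two a₂ b₂ 1#
  factor₂ false x a₂ b₂ = V F two x a₂ b₂

  -- the slice matrix for a diagonal, the climbing pattern of both rows and
  -- the values a_α at column t and b_α at column t + 1
  sliceMatrix : Diag → Bool → Bool → (a₁ b₁ a₂ b₂ : Carrier) → Mat F
  sliceMatrix swne climb₁ climb₂ a₁ b₁ a₂ b₂ = factor₂ climb₂ a₁ a₂ b₂ ⊛ factor₁ climb₁ a₁ b₁ b₂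
  sliceMatrix nwse climb₁ climb₂ a₁ b₁ a₂ b₂ = factor₁ climb₁ a₁ b₁ a₂ ⊛ factor₂ climb₂ b₁ a₂ b₂

  value : Boundary → Idx → ℤ → Carrier
  value k α s = T α s (k α s)

  sliceAt : Boundary → Diag → ℤ → Mat F
  sliceAt k D s = sliceMatrix D (climbs k one s) (climbs k two s)
                    (value k one s) (value k one (s + 1ℤ)) (value k two s) (value k two (s + 1ℤ))

  slice≈sliceAt : ∀ k d s → Slice F k T d s ≈ᴹ sliceAt k (d s) s
  slice≈sliceAt k d s = entrywise λ i l → Field.reflexive F (unfold i l)
    where
    unfold : ∀ i l → Slice F k T d s i l ≡ sliceAt k (d s) s i l
    unfold i l with d s
    ... | swne with k one (s + 1ℤ) Z.≟ k one s + 1ℤ | k two (s + 1ℤ) Z.≟ k two s + 1ℤ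
    ...   | yes _ | yes _ = refl
    ...   | yes _ | no _  = refl
    ...   | no _  | yes _ = refl
    ...   | no _  | no _  = refl
    unfold i l | nwse with k one (s + 1ℤ) Z.≟ k one s + 1ℤ | k two (s + 1ℤ) Z.≟ k two s + 1ℤ
    ...   | yes _ | yes _ = refl
    ...   | yes _ | no _  = refl
    ...   | no _  | yes _ = refl
    ...   | no _  | no _  = refl

  sliceAt-is : ∀ k D s {climb₁ climb₂ a₁ b₁ a₂ b₂} →
    climbs k one s ≡ climb₁ → climbs k two s ≡ climb₂ →
    value k one s ≡ a₁ → value k one (s + 1ℤ) ≡ b₁ → value k two s ≡ a₂ → value k two (s + 1ℤ) ≡ b₂ →
    sliceAt k D s ≡ sliceMatrix D climb₁ climb₂ a₁ b₁ a₂ b₂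
  sliceAt-is k D s refl refl refl refl refl refl = refl

  boundary-nonzero : ∀ {k} → Admissible k → NonzeroAbove F k T → ∀ α s → ¬ (value k α s ≈ 0#)
  boundary-nonzero {k} adm nonzero α s = nonzero α s (k α s) (Admissible.parity adm α s) ZP.≤-refl

  both-diagonals : ∀ {k} → Admissible k → NonzeroAbove F k T → ∀ s →
                   DiagOK k s swne → DiagOK k s nwse → sliceAt k swne s ≈ᴹ sliceAt k nwse s
  both-diagonals {k} adm nonzero s sw nw with vertical-step adm s
  ... | up k₂≡ =
    ≈ᴹ-trans (≡⇒≈ᴹ (sliceAt-is k swne s climb₁ climb₂ refl refl refl refl))
      (≈ᴹ-trans (slice-diagonals-up _ _ _ _ (b≉0 one) (b≉0 two))
                (≡⇒≈ᴹ (sym (sliceAt-is k nwse s climb₁ climb₂ refl refl refl refl))))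
    where
    b≉0 : ∀ α → ¬ (value k α (s + 1ℤ) ≈ 0#)
    b≉0 α = boundary-nonzero adm nonzero α (s + 1ℤ)
    climb₁ : climbs k one s ≡ true
    climb₁ = climbs-true k one s (trans nw k₂≡)
    climb₂ : climbs k two s ≡ false
    climb₂ = climbs-false k two s (trans (sym sw) (trans (sym (pred-suc (k one s))) (cong (_- 1ℤ) (sym k₂≡))))
  ... | down k₂≡ =
    ≈ᴹ-trans (≡⇒≈ᴹ (sliceAt-is k swne s climb₁ climb₂ refl refl refl refl))
      (≈ᴹ-trans (slice-diagonals-down _ _ _ _ _ _)
                (≡⇒≈ᴹ (sym (sliceAt-is k nwse s climb₁ climb₂ refl refl refl refl))))
    where
    climb₁ : climbs k one s ≡ false
    climb₁ = climbs-false k one s (trans nw k₂≡)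
    climb₂ : climbs k two s ≡ true
    climb₂ = climbs-true k two s (trans (sym sw) (trans (sym (suc-pred (k one s))) (cong (_+ 1ℤ) (sym k₂≡))))

  diagonal-free : ∀ {k} → Admissible k → NonzeroAbove F k T → ∀ s {D D′} →
                  DiagOK k s D → DiagOK k s D′ → sliceAt k D s ≈ᴹ sliceAt k D′ s
  diagonal-free adm nonzero s {swne} {swne} _ _ = ≈ᴹ-refl
  diagonal-free adm nonzero s {nwse} {nwse} _ _ = ≈ᴹ-refl
  diagonal-free adm nonzero s {swne} {nwse} sw nw = both-diagonals adm nonzero s sw nw
  diagonal-free adm nonzero s {nwse} {swne} nw sw = ≈ᴹ-sym (both-diagonals adm nonzero s sw nw)

  slice-via : ∀ {k} → Admissible k → NonzeroAbove F k T → ∀ d s D →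
              DiagOK k s (d s) → DiagOK k s D → Slice F k T d s ≈ᴹ sliceAt k D s
  slice-via adm nonzero d s D ok ok′ = ≈ᴹ-trans (slice≈sliceAt _ d s) (diagonal-free adm nonzero s ok ok′)

  sliceAt-local : ∀ k k′ D s → (∀ α → k′ α s ≡ k α s) → (∀ α → k′ α (s + 1ℤ) ≡ k α (s + 1ℤ)) →
                  sliceAt k′ D s ≡ sliceAt k D s
  sliceAt-local k k′ D s same₀ same₁ =
    sliceAt-is k′ D s (climb one) (climb two) (val s one same₀) (val (s + 1ℤ) one same₁)
                     (val s two same₀) (val (s + 1ℤ) two same₁)
    where
    climb : ∀ α → climbs k′ α s ≡ climbs k α s
    climb α = cong₂ (λ x y → does (x Z.≟ y + 1ℤ)) (same₁ α) (same₀ α)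
    val : ∀ s′ α → (∀ β → k′ β s′ ≡ k β s′) → value k′ α s′ ≡ value k α s′
    val s′ α same = cong (T α s′) (same α)

  slice-away : ∀ {k k′ t} → Admissible k → NonzeroAbove F k T → (∀ α s → s ≢ t → k′ α s ≡ k α s) →
    ∀ d d′ → Diagonals k d → Diagonals k′ d′ → ∀ s → s ≢ t - 1ℤ → s ≢ t → Slice F k T d s ≈ᴹ Slice F k′ T d′ s
  slice-away {k} {k′} {t} adm nonzero same d d′ diagonals diagonals′ s s≢t-1 s≢t =
    ≈ᴹ-trans (slice-via adm nonzero d s (d′ s) (diagonals s) (diagOK-transport (d′ s) (λ α → sym (same₀ α)) (λ α → sym (same₁ α)) (diagonals′ s)))
      (≈ᴹ-sym (≈ᴹ-trans (slice≈sliceAt k′ d′ s) (≡⇒≈ᴹ (sliceAt-local k k′ (d′ s) s same₀ same₁))))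
    where
    same₀ : ∀ α → k′ α s ≡ k α s
    same₀ α = same α s s≢t
    same₁ : ∀ α → k′ α (s + 1ℤ) ≡ k α (s + 1ℤ)
    same₁ α = same α (s + 1ℤ) (≢pred⇒suc≢ s≢t-1)

  raise-solution : ∀ {k} β t → IsTSolution F k T → IsTSolution F (raise k β t) T
  raise-solution {k} β t solution α s k′ parity above =
    solution α s k′ parity (ZP.≤-<-trans (raise-≥ k β t α s) above)

  raise-nonzero : ∀ {k} β t → NonzeroAbove F k T → NonzeroAbove F (raise k β t) T
  raise-nonzero {k} β t nonzero α s k′ parity above =
    nonzero α s k′ parity (ZP.≤-trans (raise-≥ k β t α s) above)

  mutation-relation : ∀ {k} → Admissible k → IsTSolution F k T → ∀ {β t} → LocalMin k β t →
    T β t (k β t) · T β t (k β t + + 2) ≈ value k β (t - 1ℤ) · value k β (t + 1ℤ) ⊕ value k (other β) t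
  mutation-relation {k} adm solution {β} {t} lm = begin
    T β t m · T β t (m + + 2)                           ≈⟨ *-comm _ _ ⟩
    T β t (m + + 2) · T β t m                           ≡⟨ cong₂ _·_ (cong (T β t) (+1+1 m)) (cong (T β t) (sym (pred-suc m))) ⟩
    T β t (m + 1ℤ + 1ℤ) · T β t (m + 1ℤ - 1ℤ)           ≈⟨ solution β t (m + 1ℤ) parity (<-suc m) ⟩
    T β (t + 1ℤ) (m + 1ℤ) · T β (t - 1ℤ) (m + 1ℤ) ⊕ T (other β) t (m + 1ℤ)
      ≡⟨ cong₂ _⊕_ (cong₂ _·_ (cong (T β (t + 1ℤ)) (sym right)) (cong (T β (t - 1ℤ)) (sym left)))
                   (cong (T (other β) t) (sym above)) ⟩
    value k β (t + 1ℤ) · value k β (t - 1ℤ) ⊕ value k (other β) t ≈⟨ ⊕-cong (*-comm _ _) ≈-refl ⟩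
    value k β (t - 1ℤ) · value k β (t + 1ℤ) ⊕ value k (other β) t ∎
    where
    open SetoidReasoning setoid
    open LocalMin lm
    m = k β t
    parity : Even (toℤ β + t + (m + 1ℤ) + 1ℤ)
    parity = subst Even (shift (toℤ β) t m) (even+2 {toℤ β + t + m} (Admissible.parity adm β t))
      where
      shift : ∀ a s x → a + s + x + + 2 ≡ a + s + (x + 1ℤ) + 1ℤ
      shift = solve-∀

  raised-nonzero : ∀ {k} → Admissible k → NonzeroAbove F k T → ∀ β t → ¬ (T β t (k β t + + 2) ≈ 0#)
  raised-nonzero {k} adm nonzero β t =
    nonzero β t (k β t + + 2) (parity+2 adm β t) (ZP.i≤i+j (k β t) (+ 2))

  factor₂-unitFirstRow : ∀ climb x a b → UnitFirstRow (factor₂ climb x a b)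
  factor₂-unitFirstRow true  x a b = ≈-refl , ≈-refl , ≈-refl
  factor₂-unitFirstRow false x a b = ≈-refl , ≈-refl , ≈-refl

  factor₂-firstColumn : ∀ climb x a b → FirstColumn 1# (factor₂ climb x a b)
  factor₂-firstColumn true  x a b = ≈-refl , ≈-refl , ≈-refl
  factor₂-firstColumn false x a b = ≈-refl , ≈-refl , ≈-refl

  -- Mutation at a local minimum (1, t) of height m: only the slices at
  -- u = t - 1 and t change, and their product is preserved.
  module MutationOne {k} (adm : Admissible k) (solution : IsTSolution F k T) (nonzero : NonzeroAbove F k T)
                     {t} (lm : LocalMin k one t) where
    open LocalMin lm

    k′ : Boundary
    k′ = raise k one t

    adm′ : Admissible k′
    adm′ = raise-admissible adm lm

    nonzero′ : NonzeroAbove F k′ T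
    nonzero′ = raise-nonzero one t nonzero

    u m : ℤ
    u = t - 1ℤ
    m = k one t

    a₁ c c′ b a₂ e q : Carrier
    a₁ = value k one u
    c  = value k one t
    c′ = T one t (m + + 2)
    b  = value k one (t + 1ℤ)
    a₂ = value k two u
    e  = value k two t
    q  = value k two (t + 1ℤ)

    X Y : Mat F
    X = factor₂ (climbs k two u) a₁ a₂ e
    Y = factor₂ (climbs k two t) b e q

    newLeft newRight : Mat F
    newLeft  = X ⊛ H F one a₁ c′ e
    newRight = V F one 1# c′ b ⊛ Y

    u+1≡t : u + 1ℤ ≡ t
    u+1≡t = suc-pred t

    row-two : ∀ s → k′ two s ≡ k two s
    row-two s = raise-offRow k one t two s λ ()

    k′-left : k′ one u ≡ k one u
    k′-left = raise-off k one t one u (pred≢ t)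

    k′-right : k′ one (t + 1ℤ) ≡ k one (t + 1ℤ)
    k′-right = raise-off k one t one (t + 1ℤ) (suc≢ t)

    climbs-two : ∀ s → climbs k′ two s ≡ climbs k two s
    climbs-two s = cong₂ (λ x y → does (x Z.≟ y + 1ℤ)) (row-two (s + 1ℤ)) (row-two s)

    value-two : ∀ s → value k′ two s ≡ value k two s
    value-two s = cong (T two s) (row-two s)

    old-left : ∀ d → Diagonals k d → Slice F k T d u ≈ᴹ X ⊛ V F one 1# a₁ c
    old-left d diagonals = ≈ᴹ-trans (slice-via adm nonzero d u swne (diagonals u) sw)
      (≡⇒≈ᴹ (sliceAt-is k swne u descends refl refl (cong (value k one) u+1≡t) refl (cong (value k two) u+1≡t)))
      where
      sw : k one u ≡ k two (u + 1ℤ)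
      sw = trans left (trans (sym above) (cong (k two) (sym u+1≡t)))
      descends : climbs k one u ≡ false
      descends = climbs-false k one u (trans (cong (k one) u+1≡t) (trans (sym (pred-suc m)) (cong (_- 1ℤ) (sym left))))

    old-right : ∀ d → Diagonals k d → Slice F k T d t ≈ᴹ H F one c b e ⊛ Y
    old-right d diagonals = ≈ᴹ-trans (slice-via adm nonzero d t nwse (diagonals t) (trans right (sym above)))
      (≡⇒≈ᴹ (sliceAt-is k nwse t (climbs-true k one t right) refl refl refl refl refl))

    new-left-swne : DiagOK k′ u swne
    new-left-swne = trans k′-left (trans left (trans (sym above) (sym (trans (row-two (u + 1ℤ)) (cong (k two) u+1≡t)))))

    new-right-nwse : DiagOK k′ t nwse
    new-right-nwse = trans k′-right (trans right (trans (sym above) (sym (row-two t))))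

    new-diagonals : ∀ d → Diagonals k d → Diagonals k′ (rechoose d t swne nwse)
    new-diagonals d diagonals = rechoose-ok (raise-off k one t) diagonals new-left-swne new-right-nwse

    new-left : ∀ d′ → Diagonals k′ d′ → Slice F k′ T d′ u ≈ᴹ newLeft
    new-left d′ diagonals = ≈ᴹ-trans (slice-via adm′ nonzero′ d′ u swne (diagonals u) new-left-swne)
      (≡⇒≈ᴹ (sliceAt-is k′ swne u climbs₁ (climbs-two u) (cong (T one u) k′-left) b₁ (value-two u) b₂))
      where
      k′-centre : k′ one (u + 1ℤ) ≡ m + + 2
      k′-centre = trans (cong (k′ one) u+1≡t) (raise-at k one t)
      climbs₁ : climbs k′ one u ≡ true
      climbs₁ = climbs-true k′ one u (trans k′-centre (trans (+1+1 m) (cong (_+ 1ℤ) (sym (trans k′-left left)))))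
      b₁ : value k′ one (u + 1ℤ) ≡ c′
      b₁ = trans (cong (value k′ one) u+1≡t) (cong (T one t) (raise-at k one t))
      b₂ : value k′ two (u + 1ℤ) ≡ e
      b₂ = trans (value-two (u + 1ℤ)) (cong (value k two) u+1≡t)

    new-right : ∀ d′ → Diagonals k′ d′ → Slice F k′ T d′ t ≈ᴹ newRight
    new-right d′ diagonals = ≈ᴹ-trans (slice-via adm′ nonzero′ d′ t nwse (diagonals t) new-right-nwse)
      (≡⇒≈ᴹ (sliceAt-is k′ nwse t climbs₁ (climbs-two t) (cong (T one t) (raise-at k one t))
                          (cong (T one (t + 1ℤ)) k′-right) (value-two t) (value-two (t + 1ℤ))))
      where
      climbs₁ : climbs k′ one t ≡ false
      climbs₁ = climbs-false k′ one t (trans k′-right (trans right (trans (+2-1 m) (cong (_- 1ℤ) (sym (raise-at k one t))))))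

    -- the exchange relation for the T-system equation at (1, t, m + 1)
    exchange-at : V F one 1# a₁ c ⊛ H F one c b e ≈ᴹ H F one a₁ c′ e ⊛ V F one 1# c′ b
    exchange-at = exchange one 1# a₁ c c′ b e
      (boundary-nonzero adm nonzero one (t + 1ℤ)) (boundary-nonzero adm nonzero one t) (raised-nonzero adm nonzero one t)
      (≈-trans (mutation-relation adm solution lm) (⊕-cong ≈-refl (≈-sym (1· e))))

    exchange-slices : (X ⊛ V F one 1# a₁ c) ⊛ (H F one c b e ⊛ Y) ≈ᴹ newLeft ⊛ newRight
    exchange-slices = ⊛-middle {X} {V F one 1# a₁ c} {H F one c b e} {H F one a₁ c′ e} {V F one 1# c′ b} {Y} exchange-at

    mutation : ∀ d d′ → Diagonals k d → Diagonals k′ d′ →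
               Slice F k T d u ⊛ Slice F k T d t ≈ᴹ Slice F k′ T d′ u ⊛ Slice F k′ T d′ t
    mutation d d′ diagonals diagonals′ =
      ≈ᴹ-trans (⊛-cong (old-left d diagonals) (old-right d diagonals))
        (≈ᴹ-trans exchange-slices
                  (≈ᴹ-sym (⊛-cong (new-left d′ diagonals′) (new-right d′ diagonals′))))

    newLeft-unitFirstRow : UnitFirstRow newLeft
    newLeft-unitFirstRow = unitFirstRow-⊛-closed {X} {H F one a₁ c′ e}
      (factor₂-unitFirstRow (climbs k two u) a₁ a₂ e) (≈-refl , ≈-refl , ≈-refl)

    new-left-unitFirstRow : ∀ d′ → Diagonals k′ d′ → UnitFirstRow (Slice F k′ T d′ u)
    new-left-unitFirstRow d′ diagonals′ = unitFirstRow-resp (new-left d′ diagonals′) newLeft-unitFirstRow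

    newRight-firstColumn : FirstColumn (c′ / b) newRight
    newRight-firstColumn = firstColumn-⊛-closed {A = V F one 1# c′ b} {Y}
      (≈-refl , ≈-refl , ≈-refl) (factor₂-firstColumn (climbs k two t) b e q)

    new-right-firstColumn : ∀ d′ → Diagonals k′ d′ → FirstColumn (c′ / b) (Slice F k′ T d′ t)
    new-right-firstColumn d′ diagonals′ = firstColumn-resp (new-right d′ diagonals′) newRight-firstColumn

    corner : ∀ d → Diagonals k d → (Slice F k T d u ⊛ Slice F k T d t) zero zero ≈ c′ / b
    corner d diagonals =
      ≈-trans (entry (≈ᴹ-trans (⊛-cong (old-left d diagonals) (old-right d diagonals)) exchange-slices) zero zero)
        (≈-trans (unitFirstRow-⊛ {newLeft} newRight newLeft-unitFirstRow zero)
                 (proj₁ newRight-firstColumn))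

  module MutationTwo {k} (adm : Admissible k) (solution : IsTSolution F k T) (nonzero : NonzeroAbove F k T)
                     {t} (lm : LocalMin k two t) where
    open LocalMin lm

    k′ : Boundary
    k′ = raise k two t

    adm′ : Admissible k′
    adm′ = raise-admissible adm lm

    nonzero′ : NonzeroAbove F k′ T
    nonzero′ = raise-nonzero two t nonzero

    u m : ℤ
    u = t - 1ℤ
    m = k two t

    a₁ e b p c c′ q : Carrier
    a₁ = value k one u
    e  = value k one t
    b  = value k one (t + 1ℤ)
    p  = value k two u
    c  = value k two t
    c′ = T two t (m + + 2)
    q  = value k two (t + 1ℤ)

    X Y : Mat F
    X = factor₁ (climbs k one u) a₁ e p
    Y = factor₁ (climbs k one t) e b q

    u+1≡t : u + 1ℤ ≡ t
    u+1≡t = suc-pred t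

    row-one : ∀ s → k′ one s ≡ k one s
    row-one s = raise-offRow k two t one s λ ()

    k′-left : k′ two u ≡ k two u
    k′-left = raise-off k two t two u (pred≢ t)

    k′-right : k′ two (t + 1ℤ) ≡ k two (t + 1ℤ)
    k′-right = raise-off k two t two (t + 1ℤ) (suc≢ t)

    climbs-one : ∀ s → climbs k′ one s ≡ climbs k one s
    climbs-one s = cong₂ (λ x y → does (x Z.≟ y + 1ℤ)) (row-one (s + 1ℤ)) (row-one s)

    value-one : ∀ s → value k′ one s ≡ value k one s
    value-one s = cong (T one s) (row-one s)

    old-left : ∀ d → Diagonals k d → Slice F k T d u ≈ᴹ X ⊛ V F two e p c
    old-left d diagonals = ≈ᴹ-trans (slice-via adm nonzero d u nwse (diagonals u) nw)
      (≡⇒≈ᴹ (sliceAt-is k nwse u refl descends refl (cong (value k one) u+1≡t) refl (cong (value k two) u+1≡t)))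
      where
      nw : k one (u + 1ℤ) ≡ k two u
      nw = trans (cong (k one) u+1≡t) (trans above (sym left))
      descends : climbs k two u ≡ false
      descends = climbs-false k two u (trans (cong (k two) u+1≡t) (trans (sym (pred-suc m)) (cong (_- 1ℤ) (sym left))))

    old-right : ∀ d → Diagonals k d → Slice F k T d t ≈ᴹ H F two c q 1# ⊛ Y
    old-right d diagonals = ≈ᴹ-trans (slice-via adm nonzero d t swne (diagonals t) (trans above (sym right)))
      (≡⇒≈ᴹ (sliceAt-is k swne t refl (climbs-true k two t right) refl refl refl refl))

    new-left-nwse : DiagOK k′ u nwse
    new-left-nwse = trans (row-one (u + 1ℤ)) (trans (cong (k one) u+1≡t) (trans above (trans (sym left) (sym k′-left))))

    new-right-swne : DiagOK k′ t swne
    new-right-swne = trans (row-one t) (trans above (trans (sym right) (sym k′-right)))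

    new-diagonals : ∀ d → Diagonals k d → Diagonals k′ (rechoose d t nwse swne)
    new-diagonals d diagonals = rechoose-ok (raise-off k two t) diagonals new-left-nwse new-right-swne

    new-left : ∀ d′ → Diagonals k′ d′ → Slice F k′ T d′ u ≈ᴹ X ⊛ H F two p c′ 1#
    new-left d′ diagonals = ≈ᴹ-trans (slice-via adm′ nonzero′ d′ u nwse (diagonals u) new-left-nwse)
      (≡⇒≈ᴹ (sliceAt-is k′ nwse u (climbs-one u) climbs₂ (value-one u) b₁ (cong (T two u) k′-left) b₂))
      where
      k′-centre : k′ two (u + 1ℤ) ≡ m + + 2
      k′-centre = trans (cong (k′ two) u+1≡t) (raise-at k two t)
      climbs₂ : climbs k′ two u ≡ true
      climbs₂ = climbs-true k′ two u (trans k′-centre (trans (+1+1 m) (cong (_+ 1ℤ) (sym (trans k′-left left)))))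
      b₁ : value k′ one (u + 1ℤ) ≡ e
      b₁ = trans (value-one (u + 1ℤ)) (cong (value k one) u+1≡t)
      b₂ : value k′ two (u + 1ℤ) ≡ c′
      b₂ = trans (cong (value k′ two) u+1≡t) (cong (T two t) (raise-at k two t))

    new-right : ∀ d′ → Diagonals k′ d′ → Slice F k′ T d′ t ≈ᴹ V F two e c′ q ⊛ Y
    new-right d′ diagonals = ≈ᴹ-trans (slice-via adm′ nonzero′ d′ t swne (diagonals t) new-right-swne)
      (≡⇒≈ᴹ (sliceAt-is k′ swne t (climbs-one t) climbs₂ (value-one t) (value-one (t + 1ℤ))
                          (cong (T two t) (raise-at k two t)) (cong (T two (t + 1ℤ)) k′-right)))
      where
      climbs₂ : climbs k′ two t ≡ false
      climbs₂ = climbs-false k′ two t (trans k′-right (trans right (trans (+2-1 m) (cong (_- 1ℤ) (sym (raise-at k two t))))))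

    exchange-at : V F two e p c ⊛ H F two c q 1# ≈ᴹ H F two p c′ 1# ⊛ V F two e c′ q
    exchange-at = exchange two e p c c′ q 1#
      (boundary-nonzero adm nonzero two (t + 1ℤ)) (boundary-nonzero adm nonzero two t) (raised-nonzero adm nonzero two t)
      (≈-trans (mutation-relation adm solution lm) (⊕-cong ≈-refl (≈-sym (·1 e))))

    mutation : ∀ d d′ → Diagonals k d → Diagonals k′ d′ →
               Slice F k T d u ⊛ Slice F k T d t ≈ᴹ Slice F k′ T d′ u ⊛ Slice F k′ T d′ t
    mutation d d′ diagonals diagonals′ =
      ≈ᴹ-trans (⊛-cong (old-left d diagonals) (old-right d diagonals))
        (≈ᴹ-trans (⊛-middle {X} {V F two e p c} {H F two c q 1#} {H F two p c′ 1#} {V F two e c′ q} {Y} exchange-at)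
                  (≈ᴹ-sym (⊛-cong (new-left d′ diagonals′) (new-right d′ diagonals′))))

-- The induction on the boundary

module Induction {ℓᶜ ℓ : Level} (F : Field ℓᶜ ℓ) (T : Idx → ℤ → ℤ → Field.Carrier F)
                 (j kk A : ℤ) (W : N.ℕ) where
  open Field F using (Carrier; _≈_; _⁻¹; _/_; setoid; inverseʳ; reflexive)
    renaming (_*_ to _·_; refl to ≈-refl; sym to ≈-sym; trans to ≈-trans; *-cong to ·-cong;
              *-identityˡ to 1·)
  open Matrices F
  open Slices F T
  open Cone j kk A W
  open import Algebra.Solver.Ring.NaturalCoefficients.Default (Field.commutativeSemiring F)

  S : Boundary → (ℤ → Diag) → ℤ → Mat F
  S k d = Slice F k T d

  Claim : Boundary → ℤ → ℤ → N.ℕ → (ℤ → Diag) → Set ℓ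
  Claim k j₀ j₁ n d = T one j kk ≈ value k one j₁ · prod (S k d) j₀ n zero zero

  ClaimOn : Boundary → Set ℓ
  ClaimOn k = ∀ {j₀ j₁ n} → Window k j₀ j₁ n → IsTSolution F k T → NonzeroAbove F k T →
              ∀ d → Diagonals k d → Claim k j₀ j₁ n d

  cancel-outer : ∀ b M x → ¬ (b ≈ Field.0# F) → b · (M · (x / b)) ≈ x · M
  cancel-outer b M x b≉0 = ≈-trans
    (solve 4 (λ b M x b⁻ → b :* (M :* (x :* b⁻)) := (b :* b⁻) :* (x :* M)) ≈-refl b M x (b ⁻¹))
    (≈-trans (·-cong (inverseʳ b b≉0) ≈-refl) (1· _))

  prod-mutated : ∀ {k k′ t} → Admissible k → NonzeroAbove F k T → (∀ α s → s ≢ t → k′ α s ≡ k α s) →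
    ∀ d d′ → Diagonals k d → Diagonals k′ d′ →
    S k d (t - 1ℤ) ⊛ S k d t ≈ᴹ S k′ d′ (t - 1ℤ) ⊛ S k′ d′ t →
    ∀ a n → a ≤ t - 1ℤ → t < a + + n → prod (S k d) a n ≈ᴹ prod (S k′ d′) a n
  prod-mutated {k} {k′} {t} adm nonzero same d d′ diagonals diagonals′ pair a n a≤ <a+n =
    prod-local (S k d) (S k′ d′) (t - 1ℤ) a n
      (λ s s≢u s≢u+1 → slice-away adm nonzero same d d′ diagonals diagonals′ s s≢u (λ s≡t → s≢u+1 (trans s≡t (sym (suc-pred t)))))
      (subst (λ t′ → S k d (t - 1ℤ) ⊛ S k d t′ ≈ᴹ S k′ d′ (t - 1ℤ) ⊛ S k′ d′ t′) (sym (suc-pred t)) pair)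
      a≤ (subst (_< a + + n) (sym (suc-pred t)) <a+n)

  cancel-inner : ∀ b x → ¬ (b ≈ Field.0# F) → b · (x / b) ≈ x
  cancel-inner b x b≉0 = ≈-trans
    (solve 3 (λ b x b⁻ → b :* (x :* b⁻) := (b :* b⁻) :* x) ≈-refl b x (b ⁻¹))
    (≈-trans (·-cong (inverseʳ b b≉0) ≈-refl) (1· x))

  module Cases {k j₀ j₁ n} (w : Window k j₀ j₁ (N.suc n)) (solution : IsTSolution F k T) (nonzero : NonzeroAbove F k T)
              (d : ℤ → Diag) (diagonals : Diagonals k d) where
    open Window w
    open WindowFacts w

    -- base case: a window of width 2 around the apex (1, j, kk - 2) is a single mutation
    claim-narrow : Narrow → Claim k j₀ j₁ (N.suc n) d
    claim-narrow narrowWindow = subst (λ n′ → Claim k j₀ j₁ n′ d) (sym width) (begin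
      T one j kk                                       ≡⟨ cong₂ (T one) j≡j₀+1 (sym apex) ⟩
      c′                                               ≈⟨ ≈-sym (cancel-inner b c′ b≉0) ⟩
      b · (c′ / b)                                     ≈⟨ ·-cong ≈-refl (≈-sym corner-of-product) ⟩
      b · prod (S k d) j₀ 2 zero zero                  ≡⟨ cong (λ j′ → value k one j′ · prod (S k d) j₀ 2 zero zero) (sym j₁≡) ⟩
      value k one j₁ · prod (S k d) j₀ 2 zero zero     ∎)
      where
      open Narrow narrowWindow
      open MutationOne admissible solution nonzero localMin using (c′; b; corner)
      open SetoidReasoning setoid
      b≉0 : ¬ (b ≈ Field.0# F)
      b≉0 = boundary-nonzero admissible nonzero one (j₀ + 1ℤ + 1ℤ)
      corner-of-product : prod (S k d) j₀ 2 zero zero ≈ c′ / b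
      corner-of-product = ≈-trans (entry (⊛-cong (≈ᴹ-refl {S k d j₀}) (⊛-identityʳ (S k d (j₀ + 1ℤ)))) zero zero)
        (≈-trans (reflexive (cong (λ s → (S k d s ⊛ S k d (j₀ + 1ℤ)) zero zero) (sym (pred-suc j₀))))
                 (corner d diagonals))

    claim-inside : ∀ {β t} → LocalMin k β t → j₀ + 1ℤ ≤ t → t < j₁ → Window (raise k β t) j₀ j₁ (N.suc n) →
      ∀ d′ → Diagonals (raise k β t) d′ →
      S k d (t - 1ℤ) ⊛ S k d t ≈ᴹ S (raise k β t) d′ (t - 1ℤ) ⊛ S (raise k β t) d′ t →
      ClaimOn (raise k β t) → Claim k j₀ j₁ (N.suc n) d
    claim-inside {β} {t} lm j₀+1≤t t<j₁ w′ d′ diagonals′ pair rec =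
      ≈-trans (rec w′ (raise-solution β t solution) (raise-nonzero β t nonzero) d′ diagonals′)
              (·-cong (reflexive (cong (T one j₁) (raise-off k β t one j₁ j₁≢t))) (≈-sym (entry same-product zero zero)))
      where
      j₁≢t : j₁ ≢ t
      j₁≢t j₁≡t = <-irrefl (subst (t <_) j₁≡t t<j₁)
      same-product : prod (S k d) j₀ (N.suc n) ≈ᴹ prod (S (raise k β t) d′) j₀ (N.suc n)
      same-product = prod-mutated admissible nonzero (raise-off k β t) d d′ diagonals diagonals′ pair
                       j₀ (N.suc n) (<⇒≤pred (suc≤⇒< j₀+1≤t)) (subst (t <_) length t<j₁)

    claim-raise-two : ∀ {t} → LocalMin k two t → j₀ + 1ℤ ≤ t → t < j₁ → ClaimOn (raise k two t) → Claim k j₀ j₁ (N.suc n) d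
    claim-raise-two {t} lm j₀+1≤t t<j₁ =
      claim-inside lm j₀+1≤t t<j₁ (raise-window-two w lm) _ (new-diagonals d diagonals) (mutation d _ diagonals (new-diagonals d diagonals))
      where open MutationTwo admissible solution nonzero lm using (mutation; new-diagonals)

    claim-raise-interior : ∀ {t} → LocalMin k one t → j₀ + 1ℤ ≤ t → t < j₁ → t ≢ j₀ + 1ℤ → t ≢ j₁ - 1ℤ →
      ClaimOn (raise k one t) → Claim k j₀ j₁ (N.suc n) d
    claim-raise-interior {t} lm j₀+1≤t t<j₁ t≢j₀+1 t≢j₁-1 =
      claim-inside lm j₀+1≤t t<j₁ (raise-window-interior w lm j₀+1≤t t<j₁ t≢j₀+1 t≢j₁-1)
        _ (new-diagonals d diagonals) (mutation d _ diagonals (new-diagonals d diagonals))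
      where open MutationOne admissible solution nonzero lm using (mutation; new-diagonals)

    -- raising the first interior point of row one: the window loses its first column,
    -- whose new slice has first row (1, 0, 0)
    claim-raise-left : ∀ {t} → LocalMin k one t → t ≡ j₀ + 1ℤ → k one t + + 2 < kk →
      ClaimOn (raise k one t) → Claim k j₀ j₁ (N.suc n) d
    claim-raise-left {t} lm refl below rec =
      ≈-trans (rec w′ (raise-solution one t solution) (raise-nonzero one t nonzero) d′ diagonals′)
              (·-cong (reflexive (cong (T one j₁) (raise-off k one t one j₁ j₁≢t))) (≈-sym corner-of-product))
      where
      open MutationOne admissible solution nonzero lm using (mutation; new-diagonals; new-left-unitFirstRow)
      k′ : Boundary
      k′ = raise k one t
      d′ : ℤ → Diag
      d′ = rechoose d t swne nwse
      diagonals′ : Diagonals k′ d′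
      diagonals′ = new-diagonals d diagonals
      w′ : Window k′ t j₁ n
      w′ = raise-window-left w lm refl below
      j₁≢t : j₁ ≢ t
      j₁≢t j₁≡t = <-irrefl (ZP.<-trans (Window.j₀<j w′) (subst (j <_) j₁≡t j<j₁))
      same-product : prod (S k d) j₀ (N.suc n) ≈ᴹ prod (S k′ d′) j₀ (N.suc n)
      same-product = prod-mutated admissible nonzero (raise-off k one t) d d′ diagonals diagonals′
                       (mutation d d′ diagonals diagonals′) j₀ (N.suc n)
                       (ZP.≤-reflexive (sym (pred-suc j₀))) (subst (t <_) length (ZP.<-trans (Window.j₀<j w′) j<j₁))
      first-unit : UnitFirstRow (S k′ d′ j₀)
      first-unit = subst (λ s → UnitFirstRow (S k′ d′ s)) (pred-suc j₀) (new-left-unitFirstRow d′ diagonals′)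
      corner-of-product : prod (S k d) j₀ (N.suc n) zero zero ≈ prod (S k′ d′) t n zero zero
      corner-of-product = ≈-trans (entry same-product zero zero)
                                  (unitFirstRow-⊛ {S k′ d′ j₀} (prod (S k′ d′) t n) first-unit zero)

    -- raising the last interior point of row one: the window loses its last column,
    -- whose new slice has first column (c′/b, 0, 0)
    claim-raise-right : ∀ {t} → LocalMin k one t → t ≡ j₁ - 1ℤ → k one t + + 2 < kk →
      ClaimOn (raise k one t) → Claim k j₀ j₁ (N.suc n) d
    claim-raise-right {t} lm refl below rec = begin
      T one j kk                                                   ≈⟨ rec w′ (raise-solution one t solution) (raise-nonzero one t nonzero) d′ diagonals′ ⟩
      value k′ one t · M                                           ≡⟨ cong (λ x → T one t x · M) (raise-at k one t) ⟩
      c′ · M                                                       ≈⟨ ≈-sym (cancel-outer b M c′ b≉0) ⟩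
      b · (M · (c′ / b))                                           ≈⟨ ·-cong (reflexive b≡) (≈-sym corner-of-product) ⟩
      value k one j₁ · prod (S k d) j₀ (N.suc n) zero zero          ∎
      where
      open SetoidReasoning setoid
      open MutationOne admissible solution nonzero lm using (mutation; new-diagonals; new-right-firstColumn; c′; b)
      k′ : Boundary
      k′ = raise k one t
      d′ : ℤ → Diag
      d′ = rechoose d t swne nwse
      diagonals′ : Diagonals k′ d′
      diagonals′ = new-diagonals d diagonals
      w′ : Window k′ j₀ t n
      w′ = raise-window-right w lm refl below
      M : Carrier
      M = prod (S k′ d′) j₀ n zero zero
      b≉0 : ¬ (b ≈ Field.0# F)
      b≉0 = boundary-nonzero admissible nonzero one (t + 1ℤ)
      b≡ : b ≡ value k one j₁
      b≡ = cong (value k one) (suc-pred j₁)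
      j₀<t : j₀ < t
      j₀<t = ZP.<-trans j₀<j (Window.j<j₁ w′)
      same-product : prod (S k d) j₀ (N.suc n) ≈ᴹ prod (S k′ d′) j₀ (N.suc n)
      same-product = prod-mutated admissible nonzero (raise-off k one t) d d′ diagonals diagonals′
                       (mutation d d′ diagonals diagonals′) j₀ (N.suc n) (<⇒≤pred j₀<t) (subst (t <_) length (pred-< j₁))
      corner-of-product : prod (S k d) j₀ (N.suc n) zero zero ≈ M · (c′ / b)
      corner-of-product = ≈-trans (entry same-product zero zero)
        (≈-trans (entry (prod-snoc (S k′ d′) j₀ n) zero zero)
        (≈-trans (reflexive (cong (λ s → (prod (S k′ d′) j₀ n ⊛ S k′ d′ s) zero zero) (sym (Window.length w′))))
                 (firstColumn-⊛ {A = S k′ d′ t} (prod (S k′ d′) j₀ n) (new-right-firstColumn d′ diagonals′))))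

    claim-raise : ∀ β t → LocalMin k β t → j₀ + 1ℤ ≤ t → t < j₁ → k β t + + 2 < kk →
      ClaimOn (raise k β t) → Claim k j₀ j₁ (N.suc n) d
    claim-raise two t lm j₀+1≤t t<j₁ below = claim-raise-two lm j₀+1≤t t<j₁
    claim-raise one t lm j₀+1≤t t<j₁ below with t Z.≟ j₀ + 1ℤ | t Z.≟ j₁ - 1ℤ
    ... | yes t≡j₀+1 | _           = claim-raise-left lm t≡j₀+1 below
    ... | no _       | yes t≡j₁-1  = claim-raise-right lm t≡j₁-1 below
    ... | no t≢j₀+1  | no t≢j₁-1   = claim-raise-interior lm j₀+1≤t t<j₁ t≢j₀+1 t≢j₁-1

  claim-step : ∀ {k j₀ j₁ n} → Window k j₀ j₁ (N.suc (N.suc n)) → IsTSolution F k T → NonzeroAbove F k T →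
    (∀ β t → A ≤ t → t < A + + W → k β t + + 2 ≤ kk → ClaimOn (raise k β t)) →
    ∀ d → Diagonals k d → Claim k j₀ j₁ (N.suc (N.suc n)) d
  claim-step {k} {j₀} {j₁} {n} w solution nonzero claim-raised d diagonals = from-lowest (window-min k (j₀ + 1ℤ) n)
    where
    open Window w
    open WindowFacts w
    open Cases w solution nonzero d diagonals
    from-lowest : WindowMin k (j₀ + 1ℤ) (N.suc n) → Claim k j₀ j₁ (N.suc (N.suc n)) d
    from-lowest lowest = by-height (k β t + + 2 ZP.<? kk)
      where
      open WindowMin lowest
      j₁≡ : j₁ ≡ j₀ + 1ℤ + + N.suc n
      j₁≡ = trans length (sym (+-suc-+ j₀ (N.suc n)))
      t<j₁ : t < j₁
      t<j₁ = subst (t <_) (sym j₁≡) t<a+n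
      bound : LowerBound k j₀ j₁ (k β t)
      bound α s j₀+1≤s s<j₁ = minimal α s j₀+1≤s (subst (s <_) j₁≡ s<j₁)
      by-height : Dec (k β t + + 2 < kk) → Claim k j₀ j₁ (N.suc (N.suc n)) d
      by-height (no not-below) = claim-narrow (narrow bound (ZP.≮⇒≥ not-below))
      by-height (yes below)    = claim-raise β t (interior-min-local β t a≤t t<j₁ bound) a≤t t<j₁ below
        (claim-raised β t (ZP.≤-trans A≤j₀ (ZP.≤-trans (ZP.<⇒≤ (<-suc j₀)) a≤t)) (ZP.<-≤-trans t<j₁ j₁≤A+W) (ZP.<⇒≤ below))

  μ-raise-< : ∀ k β t {N} → A ≤ t → t < A + + W → k β t + + 2 ≤ kk → μ k N.< N.suc N → μ (raise k β t) N.< N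
  μ-raise-< k β t A≤t t< below μ<
    rewrite sym (μ-raise k β t A≤t t< below) = NP.<-≤-trans (NP.m<m+n _ (N.s≤s N.z≤n)) (NP.≤-pred μ<)

  claim : ∀ N k {j₀ j₁ n} → μ k N.< N → Window k j₀ j₁ n → IsTSolution F k T → NonzeroAbove F k T →
          ∀ d → Diagonals k d → Claim k j₀ j₁ n d
  claim N.zero k () w solution nonzero d diagonals
  claim (N.suc N) k {n = N.zero} μ< w solution nonzero d diagonals =
    ⊥-elim (<-irrefl (ZP.<-trans j₀<j (subst (j <_) (trans length (ZP.+-identityʳ _)) j<j₁)))
    where open Window w
  claim (N.suc N) k {n = N.suc N.zero} μ< w solution nonzero d diagonals =
    ⊥-elim (ZP.≤⇒≯ (<⇒suc≤ j₀<j) (subst (j <_) length j<j₁))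
    where open Window w
  claim (N.suc N) k {n = N.suc (N.suc n)} μ< w solution nonzero =
    claim-step w solution nonzero λ β t A≤t t< below → claim N (raise k β t) (μ-raise-< k β t A≤t t< below μ<)

-- The theorem: the hypotheses describe the initial window, and the parity
-- condition on (1, j, kk) is implied by them.
mainTheorem4 : ∀ {c ℓ : Level} (F : Field c ℓ) (k : Boundary) → Admissible k →
    (T : Idx → ℤ → ℤ → Field.Carrier F) →
    IsTSolution F k T → NonzeroAbove F k T →
    (d : ℤ → Diag) → (∀ t → DiagOK k t (d t)) →
    (j kk : ℤ) → Even (+ 1 + j + kk) → k one j < kk →
    (j₀ : ℤ) → j₀ - k one j₀ ≡ j - kk →
    (∀ j′ → j′ - k one j′ ≡ j - kk → j′ ≤ j₀) →
    (j₁ : ℤ) → j₁ + k one j₁ ≡ j + kk →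
    (∀ j′ → j′ + k one j′ ≡ j + kk → j₁ ≤ j′) →
    Field._≈_ F (T one j kk)
      (Field._*_ F (T one j₁ (k one j₁))
        (prodFrom F (Slice F k T d) j₀ ∣ j₁ - j₀ ∣ zero zero))
mainTheorem4 F k adm T solution nonzero d diagonals j kk _ k₁j<kk j₀ left-end j₀-max j₁ right-end j₁-min =
  claim (N.suc (μ k)) k (NP.n<1+n (μ k)) window solution nonzero d diagonals
  where
  open Induction F T j kk j₀ ∣ j₁ - j₀ ∣
  open Cone j kk j₀ ∣ j₁ - j₀ ∣ using (Window; μ)
  window : Window k j₀ j₁ ∣ j₁ - j₀ ∣
  window = initial-window adm k₁j<kk left-end j₀-max right-end j₁-min
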